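{- Let $o$ be a $\lambda\mu\mathtt{s}$-object. If $o$ is strongly normalizing for the non-erasing reduction $\to_{\overline{\lambda\mu\mathtt{s}}}$, then $o$ is strongly normalizing for the full reduction $\to_{\lambda\mu\mathtt{s}}$.
   Context: The $\lambda\mu\mathtt{s}$-calculus. Variables $x,y,\dots$, names $\alpha,\beta,\gamma,\dots$. Terms $t,u ::= x \mid \lambda x.t \mid t\,u \mid \mu\alpha.c \mid t[x/u]$; commands $c ::= [\alpha]t \mid c\langle\alpha/\!\!/\beta.u\rangle$; objects $o::=t\mid c$. $t[x/u]$ binds $x$ in $t$; $c\langle\alpha/\!\!/\beta.u\rangle$ binds $\alpha$ in $c$: $\mathrm{fv}(t[x/u])=(\mathrm{fv}(t)\setminus\{x\})\cup\mathrm{fv}(u)$, $\mathrm{fn}(c\langle\alpha/\!\!/\beta.u\rangle)=(\mathrm{fn}(c)\setminus\{\alpha\})\cup\{\beta\}\cup\mathrm{fn}(u)$; $\lambda x$ binds $x$, $\mu\alpha$ binds $\alpha$, $\mathrm{fn}([\alpha]t)=\mathrm{fn}(t)\cup\{\alpha\}$; objects up to renaming of bound symbols. $|o|_x$, $|o|_\alpha$ count free occurrences. Contexts: $\mathtt{L}::=\Box\mid\mathtt{L}[x/u]$; $\mathtt{TT}::=\Box\mid\lambda x.\mathtt{TT}\mid\mathtt{TT}\,t\mid t\,\mathtt{TT}\mid\mu\alpha.\mathtt{CT}\mid\mathtt{TT}[x/t]\mid t[x/\mathtt{TT}]$, $\mathtt{CT}::=[\alpha]\mathtt{TT}\mid\mathtt{CT}\langle\alpha/\!\!/\beta.u\rangle\mid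 c\langle\alpha/\!\!/\beta.\mathtt{TT}\rangle$; $\mathtt{TC}::=\lambda x.\mathtt{TC}\mid\mathtt{TC}\,t\mid t\,\mathtt{TC}\mid\mu\alpha.\mathtt{CC}\mid\mathtt{TC}[x/t]\mid t[x/\mathtt{TC}]$, $\mathtt{CC}::=\boxdot\mid[\alpha]\mathtt{TC}\mid\mathtt{CC}\langle\alpha/\!\!/\beta.u\rangle\mid c\langle\alpha/\!\!/\beta.\mathtt{TC}\rangle$. The rules: (B) $\mathtt{L}[\lambda x.t]\,u\to\mathtt{L}[t[x/u]]$; (c$_v$) $\mathtt{TT}[x][x/u]\to\mathtt{TT}[u][x/u]$ if $|\mathtt{TT}[x]|_x>1$; (d$_v$) $\mathtt{TT}[x][x/u]\to\mathtt{TT}[u]$ if $|\mathtt{TT}[x]|_x=1$; (w$_v$) $t[x/u]\to t$ if $x\notin\mathrm{fv}(t)$; (M) $\mathtt{L}[\mu\alpha.c]\,u\to\mathtt{L}[\mu\gamma.c\langle\alpha/\!\!/\gamma.u\rangle]$, $\gamma$ fresh; (c$_n$) $\mathtt{CC}[[\alpha]t]\langle\alpha/\!\!/\gamma.u\rangle\to\mathtt{CC}[[\gamma]t\,u]\langle\alpha/\!\!/\gamma.u\rangle$ if $|\mathtt{CC}[[\alpha]t]|_\alpha>1$; (d$_n$) $\mathtt{CC}[[\alpha]t]\langle\alpha/\!\!/\gamma.u\rangle\to\mathtt{CC}[[\gamma]t\,u]$ if $|\mathtt{CC}[[\alpha]t]|_\alpha=1$; (w$_n$) $c\langle\alpha/\!\!/\gamma.u\rangle\to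 c$ if $\alpha\notin\mathrm{fn}(c)$; $\mathtt{TT}$ does not bind $x$, $\mathtt{CC}$ does not bind $\alpha,\gamma$. $\to_{\lambda\mu\mathtt{s}}$ is the closure under all contexts of all eight rules; $\to_{\overline{\lambda\mu\mathtt{s}}}$ is the closure under all contexts of all rules except (w$_v$) and (w$_n$). Strongly normalizing for a relation: no infinite sequence of steps of that relation. -}

module Defs where

-- The λμs-calculus in locally nameless-free, pure de Bruijn form.
-- Two independent index spaces: term variables and names.

open import Data.Nat using (ℕ; zero; suc; _+_; _<ᵇ_; _≡ᵇ_; _<_)
open import Data.Bool using (Bool; if_then_else_)
open import Data.List using (List; []; _∷_; length)
open import Data.Sum using (_⊎_)
open import Relation.Binary.PropositionalEquality using (_≡_)
open import Induction.WellFounded using (Acc)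
open import Function using (flip)

mutual
  data Tm : Set where
    var  : ℕ → Tm
    lam  : Tm → Tm             -- λx.t        (binds term variable 0)
    app  : Tm → Tm → Tm
    mu   : Cmd → Tm            -- μα.c        (binds name 0)
    esub : Tm → Tm → Tm        -- t[x/u]      (binds term variable 0 in t only)

  data Cmd : Set where
    named : ℕ → Tm → Cmd
    rsub  : Cmd → ℕ → Tm → Cmd   -- c⟨α//β.u⟩ (binds name 0 = α in c only; β, u outside)

data Obj : Set where
  tm  : Tm → Obj
  cmd : Cmd → Obj

shiftVar : ℕ → ℕ → ℕ → ℕ
shiftVar d c i = if i <ᵇ c then i else d + i

mutual
  shiftT : ℕ → ℕ → Tm → Tm
  shiftT d c (var i)    = var (shiftVar d c i)
  shiftT d c (lam t)    = lam (shiftT d (suc c) t)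
  shiftT d c (app t u)  = app (shiftT d c t) (shiftT d c u)
  shiftT d c (mu k)     = mu (shiftTC d c k)
  shiftT d c (esub t u) = esub (shiftT d (suc c) t) (shiftT d c u)

  shiftTC : ℕ → ℕ → Cmd → Cmd
  shiftTC d c (named a t)  = named a (shiftT d c t)
  shiftTC d c (rsub k b u) = rsub (shiftTC d c k) b (shiftT d c u)

mutual
  shiftN : ℕ → ℕ → Tm → Tm
  shiftN d c (var i)    = var i
  shiftN d c (lam t)    = lam (shiftN d c t)
  shiftN d c (app t u)  = app (shiftN d c t) (shiftN d c u)
  shiftN d c (mu k)     = mu (shiftNC d (suc c) k)
  shiftN d c (esub t u) = esub (shiftN d c t) (shiftN d c u)

  shiftNC : ℕ → ℕ → Cmd → Cmd
  shiftNC d c (named a t)  = named (shiftVar d c a) (shiftN d c t)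
  shiftNC d c (rsub k b u) = rsub (shiftNC d (suc c) k) (shiftVar d c b) (shiftN d c u)

eqCount : ℕ → ℕ → ℕ
eqCount i k = if i ≡ᵇ k then 1 else 0

mutual
  countT : ℕ → Tm → ℕ
  countT k (var i)    = eqCount i k
  countT k (lam t)    = countT (suc k) t
  countT k (app t u)  = countT k t + countT k u
  countT k (mu c)     = countTC k c
  countT k (esub t u) = countT (suc k) t + countT k u

  countTC : ℕ → Cmd → ℕ
  countTC k (named a t)  = countT k t
  countTC k (rsub c b u) = countTC k c + countT k u

mutual
  countN : ℕ → Tm → ℕ
  countN k (var i)    = 0
  countN k (lam t)    = countN k t
  countN k (app t u)  = countN k t + countN k u
  countN k (mu c)     = countNC (suc k) c
  countN k (esub t u) = countN k t + countN k u

  countNC : ℕ → Cmd → ℕ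
  countNC k (named a t)  = eqCount a k + countN k t
  countNC k (rsub c b u) = countNC (suc k) c + eqCount b k + countN k u

-- L ::= □ | L[x/u] ;  the list head is the outermost substitution
LCtx : Set
LCtx = List Tm

plugL : LCtx → Tm → Tm
plugL []       t = t
plugL (u ∷ us) t = esub (plugL us t) u

mutual
  data TT : Set where
    hole  : TT
    lamT  : TT → TT
    appTL : TT → Tm → TT
    appTR : Tm → TT → TT
    muT   : CT → TT
    esTL  : TT → Tm → TT
    esTR  : Tm → TT → TT

  data CT : Set where
    namedT : ℕ → TT → CT
    rsTL   : CT → ℕ → Tm → CT
    rsTR   : Cmd → ℕ → TT → CT

mutual
  plugTT : TT → Tm → Tm
  plugTT hole        s = s
  plugTT (lamT C)    s = lam (plugTT C s)
  plugTT (appTL C t) s = app (plugTT C s) t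
  plugTT (appTR t C) s = app t (plugTT C s)
  plugTT (muT C)     s = mu (plugCT C s)
  plugTT (esTL C t)  s = esub (plugTT C s) t
  plugTT (esTR t C)  s = esub t (plugTT C s)

  plugCT : CT → Tm → Cmd
  plugCT (namedT a C)  s = named a (plugTT C s)
  plugCT (rsTL C b u)  s = rsub (plugCT C s) b u
  plugCT (rsTR c b C)  s = rsub c b (plugTT C s)

mutual
  tbTT : TT → ℕ
  tbTT hole        = 0
  tbTT (lamT C)    = suc (tbTT C)
  tbTT (appTL C t) = tbTT C
  tbTT (appTR t C) = tbTT C
  tbTT (muT C)     = tbCT C
  tbTT (esTL C t)  = suc (tbTT C)
  tbTT (esTR t C)  = tbTT C

  tbCT : CT → ℕ
  tbCT (namedT a C) = tbTT C
  tbCT (rsTL C b u) = tbCT C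
  tbCT (rsTR c b C) = tbTT C

mutual
  nbTT : TT → ℕ
  nbTT hole        = 0
  nbTT (lamT C)    = nbTT C
  nbTT (appTL C t) = nbTT C
  nbTT (appTR t C) = nbTT C
  nbTT (muT C)     = suc (nbCT C)
  nbTT (esTL C t)  = nbTT C
  nbTT (esTR t C)  = nbTT C

  nbCT : CT → ℕ
  nbCT (namedT a C) = nbTT C
  nbCT (rsTL C b u) = suc (nbCT C)
  nbCT (rsTR c b C) = nbTT C

mutual
  data TC : Set where
    lamC  : TC → TC
    appCL : TC → Tm → TC
    appCR : Tm → TC → TC
    muC   : CC → TC
    esCL  : TC → Tm → TC
    esCR  : Tm → TC → TC

  data CC : Set where
    choleC : CC
    namedC : ℕ → TC → CC
    rsCL   : CC → ℕ → Tm → CC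
    rsCR   : Cmd → ℕ → TC → CC

mutual
  plugTC : TC → Cmd → Tm
  plugTC (lamC K)    c = lam (plugTC K c)
  plugTC (appCL K t) c = app (plugTC K c) t
  plugTC (appCR t K) c = app t (plugTC K c)
  plugTC (muC K)     c = mu (plugCC K c)
  plugTC (esCL K t)  c = esub (plugTC K c) t
  plugTC (esCR t K)  c = esub t (plugTC K c)

  plugCC : CC → Cmd → Cmd
  plugCC choleC       c = c
  plugCC (namedC a K) c = named a (plugTC K c)
  plugCC (rsCL K b u) c = rsub (plugCC K c) b u
  plugCC (rsCR d b K) c = rsub d b (plugTC K c)

mutual
  tbTC : TC → ℕ
  tbTC (lamC K)    = suc (tbTC K)
  tbTC (appCL K t) = tbTC K
  tbTC (appCR t K) = tbTC K
  tbTC (muC K)     = tbCC K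
  tbTC (esCL K t)  = suc (tbTC K)
  tbTC (esCR t K)  = tbTC K

  tbCC : CC → ℕ
  tbCC choleC       = 0
  tbCC (namedC a K) = tbTC K
  tbCC (rsCL K b u) = tbCC K
  tbCC (rsCR d b K) = tbTC K

mutual
  nbTC : TC → ℕ
  nbTC (lamC K)    = nbTC K
  nbTC (appCL K t) = nbTC K
  nbTC (appCR t K) = nbTC K
  nbTC (muC K)     = suc (nbCC K)
  nbTC (esCL K t)  = nbTC K
  nbTC (esCR t K)  = nbTC K

  nbCC : CC → ℕ
  nbCC choleC       = 0
  nbCC (namedC a K) = nbTC K
  nbCC (rsCL K b u) = suc (nbCC K)
  nbCC (rsCR d b K) = nbTC K

-- u, living outside  t[x/·] , transported to the hole of C (inside x and C's binders)
insTT : TT → Tm → Tm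
insTT C u = shiftN (nbTT C) 0 (shiftT (suc (tbTT C)) 0 u)

-- u, living outside  c⟨α//γ.·⟩ , transported to the hole of K (inside α and K's binders)
insCC : CC → Tm → Tm
insCC K u = shiftT (tbCC K) 0 (shiftN (suc (nbCC K)) 0 u)

-- the term  TT[x]  (x = index 0 of the enclosing explicit substitution)
TTx : TT → Tm
TTx C = plugTT C (var (tbTT C))

-- the command  CC[[α]t]  (α = index 0 of the enclosing ⟨α//γ.u⟩)
CCα : CC → Tm → Cmd
CCα K t = plugCC K (named (nbCC K) t)

data RootT : Tm → Tm → Set where
  ruleB  : ∀ (L : LCtx) t u →
           RootT (app (plugL L (lam t)) u) (plugL L (esub t (shiftT (length L) 0 u)))
  ruleCv : ∀ (C : TT) u → 1 < countT 0 (TTx C) →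
           RootT (esub (TTx C) u) (esub (plugTT C (insTT C u)) u)
  -- (d_v): the reduct  TT[u]  lives outside the removed binder x;
  -- r is that term, i.e. weakening r by x gives TT[u] seen inside x
  ruleDv : ∀ (C : TT) u r → countT 0 (TTx C) ≡ 1 →
           shiftT 1 0 r ≡ plugTT C (insTT C u) →
           RootT (esub (TTx C) u) r
  ruleM  : ∀ (L : LCtx) c u →
           RootT (app (plugL L (mu c)) u)
                 (plugL L (mu (rsub (shiftNC 1 1 c) 0 (shiftN 1 0 (shiftT (length L) 0 u)))))

data RootC : Cmd → Cmd → Set where
  ruleCn : ∀ (K : CC) t γ u → 1 < countNC 0 (CCα K t) →
           RootC (rsub (CCα K t) γ u)
                 (rsub (plugCC K (named (nbCC K + suc γ) (app t (insCC K u)))) γ u)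
  ruleDn : ∀ (K : CC) t γ u c' → countNC 0 (CCα K t) ≡ 1 →
           shiftNC 1 0 c' ≡ plugCC K (named (nbCC K + suc γ) (app t (insCC K u))) →
           RootC (rsub (CCα K t) γ u) c'

-- erasing rules (w_v), (w_n): x ∉ fv(t) means t is a weakening
data RootWT : Tm → Tm → Set where
  ruleWv : ∀ t u → RootWT (esub (shiftT 1 0 t) u) t

data RootWC : Cmd → Cmd → Set where
  ruleWn : ∀ c γ u → RootWC (rsub (shiftNC 1 0 c) γ u) c

mutual
  data StepT (RT : Tm → Tm → Set) (RC : Cmd → Cmd → Set) : Tm → Tm → Set where
    root  : ∀ {t t'} → RT t t' → StepT RT RC t t'
    lamS  : ∀ {t t'} → StepT RT RC t t' → StepT RT RC (lam t) (lam t')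
    appL  : ∀ {t t' u} → StepT RT RC t t' → StepT RT RC (app t u) (app t' u)
    appR  : ∀ {t u u'} → StepT RT RC u u' → StepT RT RC (app t u) (app t u')
    muS   : ∀ {c c'} → StepC RT RC c c' → StepT RT RC (mu c) (mu c')
    esL   : ∀ {t t' u} → StepT RT RC t t' → StepT RT RC (esub t u) (esub t' u)
    esR   : ∀ {t u u'} → StepT RT RC u u' → StepT RT RC (esub t u) (esub t u')

  data StepC (RT : Tm → Tm → Set) (RC : Cmd → Cmd → Set) : Cmd → Cmd → Set where
    root   : ∀ {c c'} → RC c c' → StepC RT RC c c'
    namedS : ∀ {a t t'} → StepT RT RC t t' → StepC RT RC (named a t) (named a t')
    rsL    : ∀ {c c' b u} → StepC RT RC c c' → StepC RT RC (rsub c b u) (rsub c' b u)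
    rsR    : ∀ {c b u u'} → StepT RT RC u u' → StepC RT RC (rsub c b u) (rsub c b u')

data StepO (RT : Tm → Tm → Set) (RC : Cmd → Cmd → Set) : Obj → Obj → Set where
  tmS  : ∀ {t t'} → StepT RT RC t t' → StepO RT RC (tm t) (tm t')
  cmdS : ∀ {c c'} → StepC RT RC c c' → StepO RT RC (cmd c) (cmd c')

_⟶λμs_ : Obj → Obj → Set
_⟶λμs_ = StepO (λ a b → RootT a b ⊎ RootWT a b) (λ a b → RootC a b ⊎ RootWC a b)

_⟶λμs̄_ : Obj → Obj → Set
_⟶λμs̄_ = StepO RootT RootC

SN : (Obj → Obj → Set) → Obj → Set
SN R = Acc (flip R)

module Submission where

-- Write o ⊳ p ("p is an erasure of o") when p is obtained from o by
-- deleting explicit substitutions t[x/u] with x ∉ fv(t) and explicit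
-- replacements c⟨α//γ.u⟩ with α ∉ fn(c), at arbitrary depth.  Two facts drive
-- the proof:
--   * simulation: if o ⊳ p and p takes a non-erasing step to p', then o takes a
--     non-erasing step to some o' with o' ⊳ p'  (a redex of p is still present in
--     o, possibly with more occurrences of its bound symbol — then a (d) step of
--     p becomes a (c) step of o, whose garbage is again erased);
--   * absorption: if o ⊳ p and p takes an erasing step (w_v)/(w_n) to p', then
--     o ⊳ p' and p' is strictly smaller than p.
-- Hence every object p with o ⊳ p is λμs-SN, by induction on the λμs̄-SN
-- derivation of o and, inside it, on the size of p; the theorem is the case p = o.

open import Defs
open import Data.Nat using (ℕ; zero; suc; _+_; _<ᵇ_; _<_; _≤_; z≤n; s≤s; z<s; _<?_; _≟_)
open import Data.Nat.Properties
open import Data.Nat.Induction using (<-wellFounded)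
open import Algebra.Properties.CommutativeSemigroup +-commutativeSemigroup using (x∙yz≈y∙xz)
open import Data.Bool using (true; false; T)
open import Data.Unit using (tt)
open import Data.Empty using (⊥-elim)
open import Data.Product using (Σ; _×_; _,_)
open import Data.Sum using (_⊎_; inj₁; inj₂)
import Data.Sum as Sum
open import Data.List using ([]; _∷_; length)
open import Relation.Nullary using (yes; no; ¬_)
open import Relation.Binary.PropositionalEquality
open import Induction.WellFounded using (Acc; acc)

shiftVar-< : ∀ d c i → i < c → shiftVar d c i ≡ i
shiftVar-< d c i i<c with i <ᵇ c | <⇒<ᵇ i<c
... | true | _ = refl

shiftVar-≥ : ∀ d c i → c ≤ i → shiftVar d c i ≡ d + i
shiftVar-≥ d c i c≤i with i <ᵇ c in eq
... | true  = ⊥-elim (≤⇒≯ c≤i (<ᵇ⇒< i c (subst T (sym eq) tt)))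
... | false = refl

shiftVar-comm : ∀ a b k c i →
  shiftVar a (k + (b + c)) (shiftVar b k i) ≡ shiftVar b k (shiftVar a (k + c) i)
shiftVar-comm a b k c i with i <? k
... | yes i<k = begin
  shiftVar a (k + (b + c)) (shiftVar b k i) ≡⟨ cong (shiftVar a (k + (b + c))) (shiftVar-< b k i i<k) ⟩
  shiftVar a (k + (b + c)) i                ≡⟨ shiftVar-< a _ i (<-≤-trans i<k (m≤m+n k _)) ⟩
  i                                         ≡⟨ sym (shiftVar-< b k i i<k) ⟩
  shiftVar b k i                            ≡⟨ cong (shiftVar b k) (sym (shiftVar-< a _ i (<-≤-trans i<k (m≤m+n k c)))) ⟩
  shiftVar b k (shiftVar a (k + c) i)       ∎
  where open ≡-Reasoning
... | no i≮k with i <? k + c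
...   | yes i<k+c = begin
  shiftVar a (k + (b + c)) (shiftVar b k i) ≡⟨ cong (shiftVar a (k + (b + c))) (shiftVar-≥ b k i k≤i) ⟩
  shiftVar a (k + (b + c)) (b + i)          ≡⟨ shiftVar-< a _ (b + i) b+i<k+[b+c] ⟩
  b + i                                     ≡⟨ sym (shiftVar-≥ b k i k≤i) ⟩
  shiftVar b k i                            ≡⟨ cong (shiftVar b k) (sym (shiftVar-< a _ i i<k+c)) ⟩
  shiftVar b k (shiftVar a (k + c) i)       ∎
  where
  open ≡-Reasoning
  k≤i = ≮⇒≥ i≮k
  b+i<k+[b+c] : b + i < k + (b + c)
  b+i<k+[b+c] = subst (b + i <_) (x∙yz≈y∙xz b k c) (+-monoʳ-< b i<k+c)
...   | no i≮k+c = begin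
  shiftVar a (k + (b + c)) (shiftVar b k i) ≡⟨ cong (shiftVar a (k + (b + c))) (shiftVar-≥ b k i k≤i) ⟩
  shiftVar a (k + (b + c)) (b + i)          ≡⟨ shiftVar-≥ a _ (b + i) k+[b+c]≤b+i ⟩
  a + (b + i)                               ≡⟨ x∙yz≈y∙xz a b i ⟩
  b + (a + i)                               ≡⟨ sym (shiftVar-≥ b k (a + i) (≤-trans k≤i (m≤n+m i a))) ⟩
  shiftVar b k (a + i)                      ≡⟨ cong (shiftVar b k) (sym (shiftVar-≥ a _ i (≮⇒≥ i≮k+c))) ⟩
  shiftVar b k (shiftVar a (k + c) i)       ∎
  where
  open ≡-Reasoning
  k≤i = ≮⇒≥ i≮k
  k+[b+c]≤b+i : k + (b + c) ≤ b + i
  k+[b+c]≤b+i = subst (_≤ b + i) (x∙yz≈y∙xz b k c) (+-monoʳ-≤ b (≮⇒≥ i≮k+c))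

shiftVar-fuse : ∀ a b k c i → c ≤ b →
  shiftVar a (k + c) (shiftVar b k i) ≡ shiftVar (a + b) k i
shiftVar-fuse a b k c i c≤b with i <? k
... | yes i<k = begin
  shiftVar a (k + c) (shiftVar b k i) ≡⟨ cong (shiftVar a (k + c)) (shiftVar-< b k i i<k) ⟩
  shiftVar a (k + c) i                ≡⟨ shiftVar-< a _ i (<-≤-trans i<k (m≤m+n k c)) ⟩
  i                                   ≡⟨ sym (shiftVar-< (a + b) k i i<k) ⟩
  shiftVar (a + b) k i                ∎
  where open ≡-Reasoning
... | no i≮k = begin
  shiftVar a (k + c) (shiftVar b k i) ≡⟨ cong (shiftVar a (k + c)) (shiftVar-≥ b k i k≤i) ⟩
  shiftVar a (k + c) (b + i)          ≡⟨ shiftVar-≥ a _ (b + i) (subst (_≤ b + i) (+-comm c k) (+-mono-≤ c≤b k≤i)) ⟩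
  a + (b + i)                         ≡⟨ sym (+-assoc a b i) ⟩
  a + b + i                           ≡⟨ sym (shiftVar-≥ (a + b) k i k≤i) ⟩
  shiftVar (a + b) k i                ∎
  where
  open ≡-Reasoning
  k≤i = ≮⇒≥ i≮k

shiftVar-injective : ∀ c i j → shiftVar 1 c i ≡ shiftVar 1 c j → i ≡ j
shiftVar-injective c i j e with i <? c | j <? c
... | yes i<c | yes j<c = trans (sym (shiftVar-< 1 c i i<c)) (trans e (shiftVar-< 1 c j j<c))
... | yes i<c | no j≮c =
  ⊥-elim (<-irrefl refl (≤-trans i<c (≤-trans (≮⇒≥ j≮c) (≤-trans (n≤1+n j) (≤-reflexive
    (sym (trans (sym (shiftVar-< 1 c i i<c)) (trans e (shiftVar-≥ 1 c j (≮⇒≥ j≮c))))))))))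
... | no i≮c | yes j<c =
  ⊥-elim (<-irrefl refl (≤-trans j<c (≤-trans (≮⇒≥ i≮c) (≤-trans (n≤1+n i) (≤-reflexive
    (trans (sym (shiftVar-≥ 1 c i (≮⇒≥ i≮c))) (trans e (shiftVar-< 1 c j j<c))))))))
... | no i≮c | no j≮c =
  suc-injective (trans (sym (shiftVar-≥ 1 c i (≮⇒≥ i≮c))) (trans e (shiftVar-≥ 1 c j (≮⇒≥ j≮c))))

cong-rsub : ∀ {c c' b b' u u'} → c ≡ c' → b ≡ b' → u ≡ u' → rsub c b u ≡ rsub c' b' u'
cong-rsub refl refl refl = refl

mutual
  shiftT-comm : ∀ a b k c t →
    shiftT a (k + (b + c)) (shiftT b k t) ≡ shiftT b k (shiftT a (k + c) t)
  shiftT-comm a b k c (var i)    = cong var (shiftVar-comm a b k c i)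
  shiftT-comm a b k c (lam t)    = cong lam (shiftT-comm a b (suc k) c t)
  shiftT-comm a b k c (app t u)  = cong₂ app (shiftT-comm a b k c t) (shiftT-comm a b k c u)
  shiftT-comm a b k c (mu x)     = cong mu (shiftTC-comm a b k c x)
  shiftT-comm a b k c (esub t u) = cong₂ esub (shiftT-comm a b (suc k) c t) (shiftT-comm a b k c u)

  shiftTC-comm : ∀ a b k c x →
    shiftTC a (k + (b + c)) (shiftTC b k x) ≡ shiftTC b k (shiftTC a (k + c) x)
  shiftTC-comm a b k c (named n t)  = cong (named n) (shiftT-comm a b k c t)
  shiftTC-comm a b k c (rsub x n u) = cong-rsub (shiftTC-comm a b k c x) refl (shiftT-comm a b k c u)

mutual
  shiftN-comm : ∀ a b k c t →
    shiftN a (k + (b + c)) (shiftN b k t) ≡ shiftN b k (shiftN a (k + c) t)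
  shiftN-comm a b k c (var i)    = refl
  shiftN-comm a b k c (lam t)    = cong lam (shiftN-comm a b k c t)
  shiftN-comm a b k c (app t u)  = cong₂ app (shiftN-comm a b k c t) (shiftN-comm a b k c u)
  shiftN-comm a b k c (mu x)     = cong mu (shiftNC-comm a b (suc k) c x)
  shiftN-comm a b k c (esub t u) = cong₂ esub (shiftN-comm a b k c t) (shiftN-comm a b k c u)

  shiftNC-comm : ∀ a b k c x →
    shiftNC a (k + (b + c)) (shiftNC b k x) ≡ shiftNC b k (shiftNC a (k + c) x)
  shiftNC-comm a b k c (named n t)  = cong₂ named (shiftVar-comm a b k c n) (shiftN-comm a b k c t)
  shiftNC-comm a b k c (rsub x n u) =
    cong-rsub (shiftNC-comm a b (suc k) c x) (shiftVar-comm a b k c n) (shiftN-comm a b k c u)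

mutual
  shiftT-fuse : ∀ a b k c t → c ≤ b → shiftT a (k + c) (shiftT b k t) ≡ shiftT (a + b) k t
  shiftT-fuse a b k c (var i)    h = cong var (shiftVar-fuse a b k c i h)
  shiftT-fuse a b k c (lam t)    h = cong lam (shiftT-fuse a b (suc k) c t h)
  shiftT-fuse a b k c (app t u)  h = cong₂ app (shiftT-fuse a b k c t h) (shiftT-fuse a b k c u h)
  shiftT-fuse a b k c (mu x)     h = cong mu (shiftTC-fuse a b k c x h)
  shiftT-fuse a b k c (esub t u) h = cong₂ esub (shiftT-fuse a b (suc k) c t h) (shiftT-fuse a b k c u h)

  shiftTC-fuse : ∀ a b k c x → c ≤ b → shiftTC a (k + c) (shiftTC b k x) ≡ shiftTC (a + b) k x
  shiftTC-fuse a b k c (named n t)  h = cong (named n) (shiftT-fuse a b k c t h)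
  shiftTC-fuse a b k c (rsub x n u) h = cong-rsub (shiftTC-fuse a b k c x h) refl (shiftT-fuse a b k c u h)

mutual
  shiftN-fuse : ∀ a b k c t → c ≤ b → shiftN a (k + c) (shiftN b k t) ≡ shiftN (a + b) k t
  shiftN-fuse a b k c (var i)    h = refl
  shiftN-fuse a b k c (lam t)    h = cong lam (shiftN-fuse a b k c t h)
  shiftN-fuse a b k c (app t u)  h = cong₂ app (shiftN-fuse a b k c t h) (shiftN-fuse a b k c u h)
  shiftN-fuse a b k c (mu x)     h = cong mu (shiftNC-fuse a b (suc k) c x h)
  shiftN-fuse a b k c (esub t u) h = cong₂ esub (shiftN-fuse a b k c t h) (shiftN-fuse a b k c u h)

  shiftNC-fuse : ∀ a b k c x → c ≤ b → shiftNC a (k + c) (shiftNC b k x) ≡ shiftNC (a + b) k x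
  shiftNC-fuse a b k c (named n t)  h = cong₂ named (shiftVar-fuse a b k c n h) (shiftN-fuse a b k c t h)
  shiftNC-fuse a b k c (rsub x n u) h =
    cong-rsub (shiftNC-fuse a b (suc k) c x h) (shiftVar-fuse a b k c n h) (shiftN-fuse a b k c u h)

mutual
  shiftT-shiftN : ∀ a c a' c' t → shiftT a c (shiftN a' c' t) ≡ shiftN a' c' (shiftT a c t)
  shiftT-shiftN a c a' c' (var i)    = refl
  shiftT-shiftN a c a' c' (lam t)    = cong lam (shiftT-shiftN a (suc c) a' c' t)
  shiftT-shiftN a c a' c' (app t u)  = cong₂ app (shiftT-shiftN a c a' c' t) (shiftT-shiftN a c a' c' u)
  shiftT-shiftN a c a' c' (mu x)     = cong mu (shiftTC-shiftNC a c a' (suc c') x)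
  shiftT-shiftN a c a' c' (esub t u) = cong₂ esub (shiftT-shiftN a (suc c) a' c' t) (shiftT-shiftN a c a' c' u)

  shiftTC-shiftNC : ∀ a c a' c' x → shiftTC a c (shiftNC a' c' x) ≡ shiftNC a' c' (shiftTC a c x)
  shiftTC-shiftNC a c a' c' (named n t)  = cong (named _) (shiftT-shiftN a c a' c' t)
  shiftTC-shiftNC a c a' c' (rsub x n u) =
    cong-rsub (shiftTC-shiftNC a c a' (suc c') x) refl (shiftT-shiftN a c a' c' u)

eqCount-same : ∀ i → eqCount i i ≡ 1
eqCount-same zero    = refl
eqCount-same (suc i) = eqCount-same i

eqCount-≢ : ∀ i k → ¬ (i ≡ k) → eqCount i k ≡ 0
eqCount-≢ zero    zero    i≢k = ⊥-elim (i≢k refl)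
eqCount-≢ zero    (suc k) i≢k = refl
eqCount-≢ (suc i) zero    i≢k = refl
eqCount-≢ (suc i) (suc k) i≢k = eqCount-≢ i k (λ e → i≢k (cong suc e))

-- the name n + 1 + g of a (c_n) reduct never coincides with the target n
eqCount-beyond : ∀ n g → eqCount (n + suc g) n ≡ 0
eqCount-beyond zero    g = refl
eqCount-beyond (suc n) g = eqCount-beyond n g

eqCount-shift-< : ∀ i k c → k < c → eqCount (shiftVar 1 c i) k ≡ eqCount i k
eqCount-shift-< i k c k<c with i <? c
... | yes i<c = cong (λ z → eqCount z k) (shiftVar-< 1 c i i<c)
... | no i≮c  = trans (cong (λ z → eqCount z k) (shiftVar-≥ 1 c i (≮⇒≥ i≮c)))
  (trans (eqCount-≢ (suc i) k (λ e → ≤⇒≯ (≤-trans (≮⇒≥ i≮c) (n≤1+n i)) (subst (_< c) (sym e) k<c)))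
         (sym (eqCount-≢ i k (λ e → i≮c (subst (_< c) (sym e) k<c)))))

eqCount-shift-≥ : ∀ i k c → c ≤ k → eqCount (shiftVar 1 c i) (suc k) ≡ eqCount i k
eqCount-shift-≥ i k c c≤k with i <? c
... | yes i<c = trans (cong (λ z → eqCount z (suc k)) (shiftVar-< 1 c i i<c))
  (trans (eqCount-≢ i (suc k) (λ e → ≤⇒≯ (≤-trans c≤k (n≤1+n k)) (subst (_< c) e i<c)))
         (sym (eqCount-≢ i k (λ e → ≤⇒≯ c≤k (subst (_< c) e i<c)))))
... | no i≮c  = cong (λ z → eqCount z (suc k)) (shiftVar-≥ 1 c i (≮⇒≥ i≮c))

eqCount-shift-gap : ∀ d c i k → c ≤ k → k < d + c → eqCount (shiftVar d c i) k ≡ 0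
eqCount-shift-gap d c i k c≤k k<d+c with i <? c
... | yes i<c = trans (cong (λ z → eqCount z k) (shiftVar-< d c i i<c))
  (eqCount-≢ i k (λ e → ≤⇒≯ c≤k (subst (_< c) e i<c)))
... | no i≮c  = trans (cong (λ z → eqCount z k) (shiftVar-≥ d c i (≮⇒≥ i≮c)))
  (eqCount-≢ (d + i) k (λ e → ≤⇒≯ (+-monoʳ-≤ d (≮⇒≥ i≮c)) (subst (_< d + c) (sym e) k<d+c)))

gap-suc : ∀ d c k → k < d + c → suc k < d + suc c
gap-suc d c k k<d+c = subst (suc k <_) (sym (+-suc d c)) (s≤s k<d+c)

mutual
  countT-shift-< : ∀ k c t → k < c → countT k (shiftT 1 c t) ≡ countT k t
  countT-shift-< k c (var i)    h = eqCount-shift-< i k c h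
  countT-shift-< k c (lam t)    h = countT-shift-< (suc k) (suc c) t (s≤s h)
  countT-shift-< k c (app t u)  h = cong₂ _+_ (countT-shift-< k c t h) (countT-shift-< k c u h)
  countT-shift-< k c (mu x)     h = countTC-shift-< k c x h
  countT-shift-< k c (esub t u) h = cong₂ _+_ (countT-shift-< (suc k) (suc c) t (s≤s h)) (countT-shift-< k c u h)

  countTC-shift-< : ∀ k c x → k < c → countTC k (shiftTC 1 c x) ≡ countTC k x
  countTC-shift-< k c (named a t)  h = countT-shift-< k c t h
  countTC-shift-< k c (rsub x b u) h = cong₂ _+_ (countTC-shift-< k c x h) (countT-shift-< k c u h)

mutual
  countT-shift-≥ : ∀ k c t → c ≤ k → countT (suc k) (shiftT 1 c t) ≡ countT k t
  countT-shift-≥ k c (var i)    h = eqCount-shift-≥ i k c h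
  countT-shift-≥ k c (lam t)    h = countT-shift-≥ (suc k) (suc c) t (s≤s h)
  countT-shift-≥ k c (app t u)  h = cong₂ _+_ (countT-shift-≥ k c t h) (countT-shift-≥ k c u h)
  countT-shift-≥ k c (mu x)     h = countTC-shift-≥ k c x h
  countT-shift-≥ k c (esub t u) h = cong₂ _+_ (countT-shift-≥ (suc k) (suc c) t (s≤s h)) (countT-shift-≥ k c u h)

  countTC-shift-≥ : ∀ k c x → c ≤ k → countTC (suc k) (shiftTC 1 c x) ≡ countTC k x
  countTC-shift-≥ k c (named a t)  h = countT-shift-≥ k c t h
  countTC-shift-≥ k c (rsub x b u) h = cong₂ _+_ (countTC-shift-≥ k c x h) (countT-shift-≥ k c u h)

mutual
  countT-shift-gap : ∀ d k c t → c ≤ k → k < d + c → countT k (shiftT d c t) ≡ 0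
  countT-shift-gap d k c (var i)    h h' = eqCount-shift-gap d c i k h h'
  countT-shift-gap d k c (lam t)    h h' = countT-shift-gap d (suc k) (suc c) t (s≤s h) (gap-suc d c k h')
  countT-shift-gap d k c (app t u)  h h' = cong₂ _+_ (countT-shift-gap d k c t h h') (countT-shift-gap d k c u h h')
  countT-shift-gap d k c (mu x)     h h' = countTC-shift-gap d k c x h h'
  countT-shift-gap d k c (esub t u) h h' =
    cong₂ _+_ (countT-shift-gap d (suc k) (suc c) t (s≤s h) (gap-suc d c k h')) (countT-shift-gap d k c u h h')

  countTC-shift-gap : ∀ d k c x → c ≤ k → k < d + c → countTC k (shiftTC d c x) ≡ 0
  countTC-shift-gap d k c (named a t)  h h' = countT-shift-gap d k c t h h'
  countTC-shift-gap d k c (rsub x b u) h h' = cong₂ _+_ (countTC-shift-gap d k c x h h') (countT-shift-gap d k c u h h')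

mutual
  countT-shiftN : ∀ d k c t → countT k (shiftN d c t) ≡ countT k t
  countT-shiftN d k c (var i)    = refl
  countT-shiftN d k c (lam t)    = countT-shiftN d (suc k) c t
  countT-shiftN d k c (app t u)  = cong₂ _+_ (countT-shiftN d k c t) (countT-shiftN d k c u)
  countT-shiftN d k c (mu x)     = countTC-shiftNC d k (suc c) x
  countT-shiftN d k c (esub t u) = cong₂ _+_ (countT-shiftN d (suc k) c t) (countT-shiftN d k c u)

  countTC-shiftNC : ∀ d k c x → countTC k (shiftNC d c x) ≡ countTC k x
  countTC-shiftNC d k c (named a t)  = countT-shiftN d k c t
  countTC-shiftNC d k c (rsub x b u) = cong₂ _+_ (countTC-shiftNC d k (suc c) x) (countT-shiftN d k c u)

mutual
  countN-shiftT : ∀ d k c t → countN k (shiftT d c t) ≡ countN k t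
  countN-shiftT d k c (var i)    = refl
  countN-shiftT d k c (lam t)    = countN-shiftT d k (suc c) t
  countN-shiftT d k c (app t u)  = cong₂ _+_ (countN-shiftT d k c t) (countN-shiftT d k c u)
  countN-shiftT d k c (mu x)     = countNC-shiftTC d (suc k) c x
  countN-shiftT d k c (esub t u) = cong₂ _+_ (countN-shiftT d k (suc c) t) (countN-shiftT d k c u)

  countNC-shiftTC : ∀ d k c x → countNC k (shiftTC d c x) ≡ countNC k x
  countNC-shiftTC d k c (named a t)  = cong (eqCount a k +_) (countN-shiftT d k c t)
  countNC-shiftTC d k c (rsub x b u) =
    cong₂ (λ p q → p + eqCount b k + q) (countNC-shiftTC d (suc k) c x) (countN-shiftT d k c u)

mutual
  countN-shift-< : ∀ k c t → k < c → countN k (shiftN 1 c t) ≡ countN k t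
  countN-shift-< k c (var i)    h = refl
  countN-shift-< k c (lam t)    h = countN-shift-< k c t h
  countN-shift-< k c (app t u)  h = cong₂ _+_ (countN-shift-< k c t h) (countN-shift-< k c u h)
  countN-shift-< k c (mu x)     h = countNC-shift-< (suc k) (suc c) x (s≤s h)
  countN-shift-< k c (esub t u) h = cong₂ _+_ (countN-shift-< k c t h) (countN-shift-< k c u h)

  countNC-shift-< : ∀ k c x → k < c → countNC k (shiftNC 1 c x) ≡ countNC k x
  countNC-shift-< k c (named a t)  h = cong₂ _+_ (eqCount-shift-< a k c h) (countN-shift-< k c t h)
  countNC-shift-< k c (rsub x b u) h =
    cong₂ _+_ (cong₂ _+_ (countNC-shift-< (suc k) (suc c) x (s≤s h)) (eqCount-shift-< b k c h)) (countN-shift-< k c u h)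

mutual
  countN-shift-≥ : ∀ k c t → c ≤ k → countN (suc k) (shiftN 1 c t) ≡ countN k t
  countN-shift-≥ k c (var i)    h = refl
  countN-shift-≥ k c (lam t)    h = countN-shift-≥ k c t h
  countN-shift-≥ k c (app t u)  h = cong₂ _+_ (countN-shift-≥ k c t h) (countN-shift-≥ k c u h)
  countN-shift-≥ k c (mu x)     h = countNC-shift-≥ (suc k) (suc c) x (s≤s h)
  countN-shift-≥ k c (esub t u) h = cong₂ _+_ (countN-shift-≥ k c t h) (countN-shift-≥ k c u h)

  countNC-shift-≥ : ∀ k c x → c ≤ k → countNC (suc k) (shiftNC 1 c x) ≡ countNC k x
  countNC-shift-≥ k c (named a t)  h = cong₂ _+_ (eqCount-shift-≥ a k c h) (countN-shift-≥ k c t h)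
  countNC-shift-≥ k c (rsub x b u) h =
    cong₂ _+_ (cong₂ _+_ (countNC-shift-≥ (suc k) (suc c) x (s≤s h)) (eqCount-shift-≥ b k c h)) (countN-shift-≥ k c u h)

mutual
  countN-shift-gap : ∀ d k c t → c ≤ k → k < d + c → countN k (shiftN d c t) ≡ 0
  countN-shift-gap d k c (var i)    h h' = refl
  countN-shift-gap d k c (lam t)    h h' = countN-shift-gap d k c t h h'
  countN-shift-gap d k c (app t u)  h h' = cong₂ _+_ (countN-shift-gap d k c t h h') (countN-shift-gap d k c u h h')
  countN-shift-gap d k c (mu x)     h h' = countNC-shift-gap d (suc k) (suc c) x (s≤s h) (gap-suc d c k h')
  countN-shift-gap d k c (esub t u) h h' = cong₂ _+_ (countN-shift-gap d k c t h h') (countN-shift-gap d k c u h h')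

  countNC-shift-gap : ∀ d k c x → c ≤ k → k < d + c → countNC k (shiftNC d c x) ≡ 0
  countNC-shift-gap d k c (named a t)  h h' = cong₂ _+_ (eqCount-shift-gap d c a k h h') (countN-shift-gap d k c t h h')
  countNC-shift-gap d k c (rsub x b u) h h' =
    cong₂ _+_ (cong₂ _+_ (countNC-shift-gap d (suc k) (suc c) x (s≤s h) (gap-suc d c k h')) (eqCount-shift-gap d c b k h h'))
              (countN-shift-gap d k c u h h')

unshiftVar : ∀ c i → eqCount i c ≡ 0 → Σ ℕ λ j → shiftVar 1 c j ≡ i
unshiftVar c i h with i <? c
... | yes i<c = i , shiftVar-< 1 c i i<c
unshiftVar zero    zero h | no _ = ⊥-elim (1+n≢0 h)
unshiftVar (suc c) zero h | no i≮c = ⊥-elim (i≮c z<s)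
unshiftVar c (suc j) h | no i≮c with c ≟ suc j
... | yes refl = ⊥-elim (1+n≢0 (trans (sym (eqCount-same (suc j))) h))
... | no c≢   = j , shiftVar-≥ 1 c j (≤-pred (≤∧≢⇒< (≮⇒≥ i≮c) c≢))

mutual
  unshiftT : ∀ c t → countT c t ≡ 0 → Σ Tm λ r → shiftT 1 c r ≡ t
  unshiftT c (var i) h with unshiftVar c i h
  ... | j , e = var j , cong var e
  unshiftT c (lam t) h with unshiftT (suc c) t h
  ... | r , e = lam r , cong lam e
  unshiftT c (app t u) h with unshiftT c t (m+n≡0⇒m≡0 _ h) | unshiftT c u (m+n≡0⇒n≡0 (countT c t) h)
  ... | r , e | r' , e' = app r r' , cong₂ app e e'
  unshiftT c (mu x) h with unshiftTC c x h
  ... | r , e = mu r , cong mu e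
  unshiftT c (esub t u) h with unshiftT (suc c) t (m+n≡0⇒m≡0 _ h) | unshiftT c u (m+n≡0⇒n≡0 (countT (suc c) t) h)
  ... | r , e | r' , e' = esub r r' , cong₂ esub e e'

  unshiftTC : ∀ c x → countTC c x ≡ 0 → Σ Cmd λ r → shiftTC 1 c r ≡ x
  unshiftTC c (named a t) h with unshiftT c t h
  ... | r , e = named a r , cong (named a) e
  unshiftTC c (rsub x b u) h with unshiftTC c x (m+n≡0⇒m≡0 _ h) | unshiftT c u (m+n≡0⇒n≡0 (countTC c x) h)
  ... | r , e | r' , e' = rsub r b r' , cong-rsub e refl e'

mutual
  unshiftN : ∀ c t → countN c t ≡ 0 → Σ Tm λ r → shiftN 1 c r ≡ t
  unshiftN c (var i) h = var i , refl
  unshiftN c (lam t) h with unshiftN c t h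
  ... | r , e = lam r , cong lam e
  unshiftN c (app t u) h with unshiftN c t (m+n≡0⇒m≡0 _ h) | unshiftN c u (m+n≡0⇒n≡0 (countN c t) h)
  ... | r , e | r' , e' = app r r' , cong₂ app e e'
  unshiftN c (mu x) h with unshiftNC (suc c) x h
  ... | r , e = mu r , cong mu e
  unshiftN c (esub t u) h with unshiftN c t (m+n≡0⇒m≡0 _ h) | unshiftN c u (m+n≡0⇒n≡0 (countN c t) h)
  ... | r , e | r' , e' = esub r r' , cong₂ esub e e'

  unshiftNC : ∀ c x → countNC c x ≡ 0 → Σ Cmd λ r → shiftNC 1 c r ≡ x
  unshiftNC c (named a t) h with unshiftVar c a (m+n≡0⇒m≡0 _ h) | unshiftN c t (m+n≡0⇒n≡0 (eqCount a c) h)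
  ... | j , e | r , e' = named j r , cong₂ named e e'
  unshiftNC c (rsub x b u) h
    with unshiftNC (suc c) x (m+n≡0⇒m≡0 _ (m+n≡0⇒m≡0 _ h))
       | unshiftVar c b (m+n≡0⇒n≡0 (countNC (suc c) x) (m+n≡0⇒m≡0 _ h))
       | unshiftN c u (m+n≡0⇒n≡0 (countNC (suc c) x + eqCount b c) h)
  ... | r , e | j , e' | r' , e'' = rsub r j r' , cong-rsub e e' e''

-- The rules locate the occurrence to be replaced through a context and
-- read its index off the context's binders.  For induction it is better to
-- describe the same replacements structurally, keeping track of the number n
-- of binders of the replaced symbol's kind and m of the other kind crossed so far.

-- u placed under x, n further variable binders and m name binders
substArg : ℕ → ℕ → Tm → Tm
substArg n m u = shiftN m 0 (shiftT (suc n) 0 u)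

-- u placed under α, n further name binders and m variable binders
replArg : ℕ → ℕ → Tm → Tm
replArg n m u = shiftT m 0 (shiftN (suc n) 0 u)

-- VarRepT u n m A B:  B is A with one free occurrence of variable n replaced by u
-- (the step of (c_v) and (d_v)).
mutual
  data VarRepT (u : Tm) : ℕ → ℕ → Tm → Tm → Set where
    rvar  : ∀ {n m} → VarRepT u n m (var n) (substArg n m u)
    rlam  : ∀ {n m t t'} → VarRepT u (suc n) m t t' → VarRepT u n m (lam t) (lam t')
    rappL : ∀ {n m t t' s} → VarRepT u n m t t' → VarRepT u n m (app t s) (app t' s)
    rappR : ∀ {n m t s s'} → VarRepT u n m s s' → VarRepT u n m (app t s) (app t s')
    rmu   : ∀ {n m c c'} → VarRepC u n (suc m) c c' → VarRepT u n m (mu c) (mu c')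
    resL  : ∀ {n m t t' s} → VarRepT u (suc n) m t t' → VarRepT u n m (esub t s) (esub t' s)
    resR  : ∀ {n m t s s'} → VarRepT u n m s s' → VarRepT u n m (esub t s) (esub t s')

  data VarRepC (u : Tm) : ℕ → ℕ → Cmd → Cmd → Set where
    rnamed : ∀ {n m a t t'} → VarRepT u n m t t' → VarRepC u n m (named a t) (named a t')
    rrsL   : ∀ {n m c c' b s} → VarRepC u n (suc m) c c' → VarRepC u n m (rsub c b s) (rsub c' b s)
    rrsR   : ∀ {n m c b s s'} → VarRepT u n m s s' → VarRepC u n m (rsub c b s) (rsub c b s')

-- NameRepC g u n m A B:  B is A with one command [n]t replaced by [n+1+g](t u)
-- (the step of (c_n) and (d_n), γ being the outer name g).
mutual
  data NameRepT (g : ℕ) (u : Tm) : ℕ → ℕ → Tm → Tm → Set where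
    nlam  : ∀ {n m t t'} → NameRepT g u n (suc m) t t' → NameRepT g u n m (lam t) (lam t')
    nappL : ∀ {n m t t' s} → NameRepT g u n m t t' → NameRepT g u n m (app t s) (app t' s)
    nappR : ∀ {n m t s s'} → NameRepT g u n m s s' → NameRepT g u n m (app t s) (app t s')
    nmu   : ∀ {n m c c'} → NameRepC g u (suc n) m c c' → NameRepT g u n m (mu c) (mu c')
    nesL  : ∀ {n m t t' s} → NameRepT g u n (suc m) t t' → NameRepT g u n m (esub t s) (esub t' s)
    nesR  : ∀ {n m t s s'} → NameRepT g u n m s s' → NameRepT g u n m (esub t s) (esub t s')

  data NameRepC (g : ℕ) (u : Tm) : ℕ → ℕ → Cmd → Cmd → Set where
    nhere  : ∀ {n m t} → NameRepC g u n m (named n t) (named (n + suc g) (app t (replArg n m u)))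
    nnamed : ∀ {n m a t t'} → NameRepT g u n m t t' → NameRepC g u n m (named a t) (named a t')
    nrsL   : ∀ {n m c c' b s} → NameRepC g u (suc n) m c c' → NameRepC g u n m (rsub c b s) (rsub c' b s)
    nrsR   : ∀ {n m c b s s'} → NameRepT g u n m s s' → NameRepC g u n m (rsub c b s) (rsub c b s')

-- BetaAt u d X Y:  X = L[λx.t] and Y = L[t[x/u]], where d variable binders of L
-- have already been crossed (so u is weakened by them).
data BetaAt (u : Tm) : ℕ → Tm → Tm → Set where
  bhere : ∀ {d t} → BetaAt u d (lam t) (esub t (shiftT d 0 u))
  besub : ∀ {d X Y w} → BetaAt u (suc d) X Y → BetaAt u d (esub X w) (esub Y w)

-- μγ.c⟨α//γ.v⟩ for a fresh γ (v already lives outside μγ)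
muApp : Cmd → Tm → Tm
muApp c v = mu (rsub (shiftNC 1 1 c) 0 (shiftN 1 0 v))

-- MuAppAt u d X Y:  X = L[μα.c] and Y = L[μγ.c⟨α//γ.u⟩], d as for BetaAt.
data MuAppAt (u : Tm) : ℕ → Tm → Tm → Set where
  mhere : ∀ {d c} → MuAppAt u d (mu c) (muApp c (shiftT d 0 u))
  mesub : ∀ {d X Y w} → MuAppAt u (suc d) X Y → MuAppAt u d (esub X w) (esub Y w)

data RedexT : Tm → Tm → Set where
  redB  : ∀ {u X Y} → BetaAt u 0 X Y → RedexT (app X u) Y
  redM  : ∀ {u X Y} → MuAppAt u 0 X Y → RedexT (app X u) Y
  redCv : ∀ {u A B} → VarRepT u 0 0 A B → 1 < countT 0 A → RedexT (esub A u) (esub B u)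
  redDv : ∀ {u A B r} → VarRepT u 0 0 A B → countT 0 A ≡ 1 → shiftT 1 0 r ≡ B → RedexT (esub A u) r

data RedexC : Cmd → Cmd → Set where
  redCn : ∀ {g u c c'} → NameRepC g u 0 0 c c' → 1 < countNC 0 c → RedexC (rsub c g u) (rsub c' g u)
  redDn : ∀ {g u c c' r} → NameRepC g u 0 0 c c' → countNC 0 c ≡ 1 → shiftNC 1 0 r ≡ c' → RedexC (rsub c g u) r

VarRepAtTT : Tm → ℕ → ℕ → TT → ℕ → ℕ → Set
VarRepAtTT u n m C k j = VarRepT u n m (plugTT C (var k)) (plugTT C (substArg k j u))

VarRepAtCT : Tm → ℕ → ℕ → CT → ℕ → ℕ → Set
VarRepAtCT u n m C k j = VarRepC u n m (plugCT C (var k)) (plugCT C (substArg k j u))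

NameRepAtTC : ℕ → Tm → ℕ → ℕ → TC → Tm → ℕ → ℕ → Set
NameRepAtTC g u n m K t k j = NameRepT g u n m (plugTC K (named k t)) (plugTC K (named (k + suc g) (app t (replArg k j u))))

NameRepAtCC : ℕ → Tm → ℕ → ℕ → CC → Tm → ℕ → ℕ → Set
NameRepAtCC g u n m K t k j = NameRepC g u n m (plugCC K (named k t)) (plugCC K (named (k + suc g) (app t (replArg k j u))))

mutual
  varRep-plugTT : ∀ u C n m → VarRepAtTT u n m C (tbTT C + n) (nbTT C + m)
  varRep-plugTT u hole        n m = rvar
  varRep-plugTT u (lamT C)    n m =
    rlam (subst (λ k → VarRepAtTT u (suc n) m C k (nbTT C + m)) (+-suc (tbTT C) n) (varRep-plugTT u C (suc n) m))
  varRep-plugTT u (appTL C t) n m = rappL (varRep-plugTT u C n m)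
  varRep-plugTT u (appTR t C) n m = rappR (varRep-plugTT u C n m)
  varRep-plugTT u (muT C)     n m =
    rmu (subst (VarRepAtCT u n (suc m) C (tbCT C + n)) (+-suc (nbCT C) m) (varRep-plugCT u C n (suc m)))
  varRep-plugTT u (esTL C t)  n m =
    resL (subst (λ k → VarRepAtTT u (suc n) m C k (nbTT C + m)) (+-suc (tbTT C) n) (varRep-plugTT u C (suc n) m))
  varRep-plugTT u (esTR t C)  n m = resR (varRep-plugTT u C n m)

  varRep-plugCT : ∀ u C n m → VarRepAtCT u n m C (tbCT C + n) (nbCT C + m)
  varRep-plugCT u (namedT a C) n m = rnamed (varRep-plugTT u C n m)
  varRep-plugCT u (rsTL C b s) n m =
    rrsL (subst (VarRepAtCT u n (suc m) C (tbCT C + n)) (+-suc (nbCT C) m) (varRep-plugCT u C n (suc m)))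
  varRep-plugCT u (rsTR c b C) n m = rrsR (varRep-plugTT u C n m)

mutual
  nameRep-plugTC : ∀ g u K n m t → NameRepAtTC g u n m K t (nbTC K + n) (tbTC K + m)
  nameRep-plugTC g u (lamC K) n m t =
    nlam (subst (NameRepAtTC g u n (suc m) K t (nbTC K + n)) (+-suc (tbTC K) m) (nameRep-plugTC g u K n (suc m) t))
  nameRep-plugTC g u (appCL K s) n m t = nappL (nameRep-plugTC g u K n m t)
  nameRep-plugTC g u (appCR s K) n m t = nappR (nameRep-plugTC g u K n m t)
  nameRep-plugTC g u (muC K) n m t =
    nmu (subst (λ k → NameRepAtCC g u (suc n) m K t k (tbCC K + m)) (+-suc (nbCC K) n) (nameRep-plugCC g u K (suc n) m t))
  nameRep-plugTC g u (esCL K s) n m t =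
    nesL (subst (NameRepAtTC g u n (suc m) K t (nbTC K + n)) (+-suc (tbTC K) m) (nameRep-plugTC g u K n (suc m) t))
  nameRep-plugTC g u (esCR s K) n m t = nesR (nameRep-plugTC g u K n m t)

  nameRep-plugCC : ∀ g u K n m t → NameRepAtCC g u n m K t (nbCC K + n) (tbCC K + m)
  nameRep-plugCC g u choleC       n m t = nhere
  nameRep-plugCC g u (namedC a K) n m t = nnamed (nameRep-plugTC g u K n m t)
  nameRep-plugCC g u (rsCL K b s) n m t =
    nrsL (subst (λ k → NameRepAtCC g u (suc n) m K t k (tbCC K + m)) (+-suc (nbCC K) n) (nameRep-plugCC g u K (suc n) m t))
  nameRep-plugCC g u (rsCR d b K) n m t = nrsR (nameRep-plugTC g u K n m t)

betaAt-plugL : ∀ u t L d → BetaAt u d (plugL L (lam t)) (plugL L (esub t (shiftT (length L + d) 0 u)))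
betaAt-plugL u t []      d = bhere
betaAt-plugL u t (w ∷ L) d = besub (subst (λ k → BetaAt u (suc d) (plugL L (lam t)) (plugL L (esub t (shiftT k 0 u))))
                                          (+-suc (length L) d) (betaAt-plugL u t L (suc d)))

muAppAt-plugL : ∀ u c L d →
  MuAppAt u d (plugL L (mu c)) (plugL L (muApp c (shiftT (length L + d) 0 u)))
muAppAt-plugL u c []      d = mhere
muAppAt-plugL u c (w ∷ L) d = mesub (subst (λ k → MuAppAt u (suc d) (plugL L (mu c)) (plugL L (muApp c (shiftT k 0 u))))
                                           (+-suc (length L) d) (muAppAt-plugL u c L (suc d)))

mutual
  varRepT-inv : ∀ {u n m A B} → VarRepT u n m A B → Σ TT λ C →
    (A ≡ plugTT C (var (tbTT C + n))) × (B ≡ plugTT C (substArg (tbTT C + n) (nbTT C + m) u))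
  varRepT-inv rvar = hole , refl , refl
  varRepT-inv {u} {n} {m} (rlam r) with varRepT-inv r
  ... | C , refl , refl = lamT C , cong (λ k → lam (plugTT C (var k))) (+-suc (tbTT C) n)
                                 , cong (λ k → lam (plugTT C (substArg k (nbTT C + m) u))) (+-suc (tbTT C) n)
  varRepT-inv (rappL {s = s} r) with varRepT-inv r
  ... | C , refl , refl = appTL C s , refl , refl
  varRepT-inv (rappR {t = t} r) with varRepT-inv r
  ... | C , refl , refl = appTR t C , refl , refl
  varRepT-inv {u} {n} {m} (rmu r) with varRepC-inv r
  ... | C , refl , refl = muT C , refl , cong (λ j → mu (plugCT C (substArg (tbCT C + n) j u))) (+-suc (nbCT C) m)
  varRepT-inv {u} {n} {m} (resL {s = s} r) with varRepT-inv r
  ... | C , refl , refl = esTL C s , cong (λ k → esub (plugTT C (var k)) s) (+-suc (tbTT C) n)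
                                   , cong (λ k → esub (plugTT C (substArg k (nbTT C + m) u)) s) (+-suc (tbTT C) n)
  varRepT-inv (resR {t = t} r) with varRepT-inv r
  ... | C , refl , refl = esTR t C , refl , refl

  varRepC-inv : ∀ {u n m A B} → VarRepC u n m A B → Σ CT λ C →
    (A ≡ plugCT C (var (tbCT C + n))) × (B ≡ plugCT C (substArg (tbCT C + n) (nbCT C + m) u))
  varRepC-inv (rnamed {a = a} r) with varRepT-inv r
  ... | C , refl , refl = namedT a C , refl , refl
  varRepC-inv {u} {n} {m} (rrsL {b = b} {s = s} r) with varRepC-inv r
  ... | C , refl , refl = rsTL C b s , refl , cong (λ j → rsub (plugCT C (substArg (tbCT C + n) j u)) b s) (+-suc (nbCT C) m)
  varRepC-inv (rrsR {c = c} {b = b} r) with varRepT-inv r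
  ... | C , refl , refl = rsTR c b C , refl , refl

mutual
  nameRepT-inv : ∀ {g u n m A B} → NameRepT g u n m A B → Σ TC λ K → Σ Tm λ t →
    (A ≡ plugTC K (named (nbTC K + n) t)) × (B ≡ plugTC K (named (nbTC K + n + suc g) (app t (replArg (nbTC K + n) (tbTC K + m) u))))
  nameRepT-inv {g} {u} {n} {m} (nlam r) with nameRepT-inv r
  ... | K , t , refl , refl = lamC K , t , refl
    , cong (λ j → lam (plugTC K (named (nbTC K + n + suc g) (app t (replArg (nbTC K + n) j u))))) (+-suc (tbTC K) m)
  nameRepT-inv (nappL {s = s} r) with nameRepT-inv r
  ... | K , t , refl , refl = appCL K s , t , refl , refl
  nameRepT-inv (nappR {t = t'} r) with nameRepT-inv r
  ... | K , t , refl , refl = appCR t' K , t , refl , refl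
  nameRepT-inv {g} {u} {n} {m} (nmu r) with nameRepC-inv r
  ... | K , t , refl , refl = muC K , t , cong (λ k → mu (plugCC K (named k t))) (+-suc (nbCC K) n)
    , cong (λ k → mu (plugCC K (named (k + suc g) (app t (replArg k (tbCC K + m) u))))) (+-suc (nbCC K) n)
  nameRepT-inv {g} {u} {n} {m} (nesL {s = s} r) with nameRepT-inv r
  ... | K , t , refl , refl = esCL K s , t , refl
    , cong (λ j → esub (plugTC K (named (nbTC K + n + suc g) (app t (replArg (nbTC K + n) j u)))) s) (+-suc (tbTC K) m)
  nameRepT-inv (nesR {t = t'} r) with nameRepT-inv r
  ... | K , t , refl , refl = esCR t' K , t , refl , refl

  nameRepC-inv : ∀ {g u n m A B} → NameRepC g u n m A B → Σ CC λ K → Σ Tm λ t →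
    (A ≡ plugCC K (named (nbCC K + n) t)) × (B ≡ plugCC K (named (nbCC K + n + suc g) (app t (replArg (nbCC K + n) (tbCC K + m) u))))
  nameRepC-inv (nhere {t = t}) = choleC , t , refl , refl
  nameRepC-inv (nnamed {a = a} r) with nameRepT-inv r
  ... | K , t , refl , refl = namedC a K , t , refl , refl
  nameRepC-inv {g} {u} {n} {m} (nrsL {b = b} {s = s} r) with nameRepC-inv r
  ... | K , t , refl , refl = rsCL K b s , t , cong (λ k → rsub (plugCC K (named k t)) b s) (+-suc (nbCC K) n)
    , cong (λ k → rsub (plugCC K (named (k + suc g) (app t (replArg k (tbCC K + m) u)))) b s) (+-suc (nbCC K) n)
  nameRepC-inv (nrsR {c = c} {b = b} r) with nameRepT-inv r
  ... | K , t , refl , refl = rsCR c b K , t , refl , refl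

betaAt-inv : ∀ {u d X Y} → BetaAt u d X Y → Σ LCtx λ L → Σ Tm λ t →
  (X ≡ plugL L (lam t)) × (Y ≡ plugL L (esub t (shiftT (length L + d) 0 u)))
betaAt-inv bhere = [] , _ , refl , refl
betaAt-inv {u} {d} (besub {w = w} r) with betaAt-inv r
... | L , t , refl , refl = w ∷ L , t , refl , cong (λ k → esub (plugL L (esub t (shiftT k 0 u))) w) (+-suc (length L) d)

muAppAt-inv : ∀ {u d X Y} → MuAppAt u d X Y → Σ LCtx λ L → Σ Cmd λ c →
  (X ≡ plugL L (mu c)) × (Y ≡ plugL L (muApp c (shiftT (length L + d) 0 u)))
muAppAt-inv mhere = [] , _ , refl , refl
muAppAt-inv {u} {d} (mesub {w = w} r) with muAppAt-inv r
... | L , c , refl , refl = w ∷ L , c , refl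
  , cong (λ k → esub (plugL L (muApp c (shiftT k 0 u))) w) (+-suc (length L) d)

varRep-root : ∀ u C → VarRepT u 0 0 (TTx C) (plugTT C (insTT C u))
varRep-root u C = subst₂ (VarRepAtTT u 0 0 C) (+-identityʳ (tbTT C)) (+-identityʳ (nbTT C)) (varRep-plugTT u C 0 0)

varRep-root-inv : ∀ {u A B} → VarRepT u 0 0 A B → Σ TT λ C → (A ≡ TTx C) × (B ≡ plugTT C (insTT C u))
varRep-root-inv {u} r with varRepT-inv r
... | C , eA , eB = C , trans eA (cong (λ k → plugTT C (var k)) (+-identityʳ (tbTT C)))
                      , trans eB (cong₂ (λ k j → plugTT C (substArg k j u)) (+-identityʳ (tbTT C)) (+-identityʳ (nbTT C)))

nameRep-root : ∀ g u K t → NameRepC g u 0 0 (CCα K t) (plugCC K (named (nbCC K + suc g) (app t (insCC K u))))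
nameRep-root g u K t = subst₂ (NameRepAtCC g u 0 0 K t) (+-identityʳ (nbCC K)) (+-identityʳ (tbCC K)) (nameRep-plugCC g u K 0 0 t)

nameRep-root-inv : ∀ {g u A B} → NameRepC g u 0 0 A B → Σ CC λ K → Σ Tm λ t →
  (A ≡ CCα K t) × (B ≡ plugCC K (named (nbCC K + suc g) (app t (insCC K u))))
nameRep-root-inv {g} {u} r with nameRepC-inv r
... | K , t , eA , eB = K , t , trans eA (cong (λ k → plugCC K (named k t)) (+-identityʳ (nbCC K)))
  , trans eB (cong₂ (λ k j → plugCC K (named (k + suc g) (app t (replArg k j u)))) (+-identityʳ (nbCC K)) (+-identityʳ (tbCC K)))

betaAt-root : ∀ u t L → BetaAt u 0 (plugL L (lam t)) (plugL L (esub t (shiftT (length L) 0 u)))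
betaAt-root u t L = subst (λ k → BetaAt u 0 (plugL L (lam t)) (plugL L (esub t (shiftT k 0 u))))
                          (+-identityʳ (length L)) (betaAt-plugL u t L 0)

muAppAt-root : ∀ u c L → MuAppAt u 0 (plugL L (mu c)) (plugL L (muApp c (shiftT (length L) 0 u)))
muAppAt-root u c L = subst (λ k → MuAppAt u 0 (plugL L (mu c)) (plugL L (muApp c (shiftT k 0 u))))
                           (+-identityʳ (length L)) (muAppAt-plugL u c L 0)

rootT→redexT : ∀ {a b} → RootT a b → RedexT a b
rootT→redexT (ruleB L t u)       = redB (betaAt-root u t L)
rootT→redexT (ruleCv C u h)      = redCv (varRep-root u C) h
rootT→redexT (ruleDv C u r h e)  = redDv (varRep-root u C) h e
rootT→redexT (ruleM L c u)       = redM (muAppAt-root u c L)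

rootC→redexC : ∀ {a b} → RootC a b → RedexC a b
rootC→redexC (ruleCn K t γ u h)      = redCn (nameRep-root γ u K t) h
rootC→redexC (ruleDn K t γ u c' h e) = redDn (nameRep-root γ u K t) h e

redexT→rootT : ∀ {a b} → RedexT a b → RootT a b
redexT→rootT (redB {u} br) with betaAt-inv br
... | L , t , refl , refl = subst (λ k → RootT (app (plugL L (lam t)) u) (plugL L (esub t (shiftT k 0 u))))
                                  (sym (+-identityʳ (length L))) (ruleB L t u)
redexT→rootT (redM {u} mr) with muAppAt-inv mr
... | L , c , refl , refl = subst (λ k → RootT (app (plugL L (mu c)) u) (plugL L (muApp c (shiftT k 0 u))))
                                  (sym (+-identityʳ (length L))) (ruleM L c u)
redexT→rootT (redCv {u} r h) with varRep-root-inv r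
... | C , refl , refl = ruleCv C u h
redexT→rootT (redDv {u} r h e) with varRep-root-inv r
... | C , refl , refl = ruleDv C u _ h e

redexC→rootC : ∀ {a b} → RedexC a b → RootC a b
redexC→rootC (redCn {g} {u} r h) with nameRep-root-inv r
... | K , t , refl , refl = ruleCn K t g u h
redexC→rootC (redDn {g} {u} r h e) with nameRep-root-inv r
... | K , t , refl , refl = ruleDn K t g u _ h e

module _ {R R' : Tm → Tm → Set} {S S' : Cmd → Cmd → Set}
         (f : ∀ {a b} → R a b → R' a b) (g : ∀ {a b} → S a b → S' a b) where
  mutual
    mapStepT : ∀ {a b} → StepT R S a b → StepT R' S' a b
    mapStepT (root x) = root (f x)
    mapStepT (lamS s) = lamS (mapStepT s)
    mapStepT (appL s) = appL (mapStepT s)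
    mapStepT (appR s) = appR (mapStepT s)
    mapStepT (muS s)  = muS (mapStepC s)
    mapStepT (esL s)  = esL (mapStepT s)
    mapStepT (esR s)  = esR (mapStepT s)

    mapStepC : ∀ {a b} → StepC R S a b → StepC R' S' a b
    mapStepC (root x)   = root (g x)
    mapStepC (namedS s) = namedS (mapStepT s)
    mapStepC (rsL s)    = rsL (mapStepC s)
    mapStepC (rsR s)    = rsR (mapStepT s)

-- Two situations occur.  A shift whose cutoff lies between the replaced
-- occurrence and its binder inserts a binder in between: the replacement index
-- grows by one ("bump").  A shift at a cutoff outside the redex simply weakens
-- every component, including the argument u.

mutual
  varRepT-bumpT : ∀ {u} c k {m A B} → VarRepT u (c + k) m A B →
    VarRepT u (suc (c + k)) m (shiftT 1 c A) (shiftT 1 c B)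
  varRepT-bumpT {u} c k {m} rvar = subst₂ (VarRepT u (suc (c + k)) m)
    (cong var (sym (shiftVar-≥ 1 c (c + k) (m≤m+n c k))))
    (trans (cong (shiftN m 0) (sym (shiftT-fuse 1 (suc (c + k)) 0 c u (≤-trans (m≤m+n c k) (n≤1+n _)))))
           (sym (shiftT-shiftN 1 c m 0 _)))
    rvar
  varRepT-bumpT c k (rlam r)  = rlam (varRepT-bumpT (suc c) k r)
  varRepT-bumpT c k (rappL r) = rappL (varRepT-bumpT c k r)
  varRepT-bumpT c k (rappR r) = rappR (varRepT-bumpT c k r)
  varRepT-bumpT c k (rmu r)   = rmu (varRepC-bumpT c k r)
  varRepT-bumpT c k (resL r)  = resL (varRepT-bumpT (suc c) k r)
  varRepT-bumpT c k (resR r)  = resR (varRepT-bumpT c k r)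

  varRepC-bumpT : ∀ {u} c k {m A B} → VarRepC u (c + k) m A B →
    VarRepC u (suc (c + k)) m (shiftTC 1 c A) (shiftTC 1 c B)
  varRepC-bumpT c k (rnamed r) = rnamed (varRepT-bumpT c k r)
  varRepC-bumpT c k (rrsL r)   = rrsL (varRepC-bumpT c k r)
  varRepC-bumpT c k (rrsR r)   = rrsR (varRepT-bumpT c k r)

mutual
  varRepT-bumpN : ∀ {u} c k {n A B} → VarRepT u n (c + k) A B →
    VarRepT u n (suc (c + k)) (shiftN 1 c A) (shiftN 1 c B)
  varRepT-bumpN {u} c k {n} rvar = subst (VarRepT u n (suc (c + k)) (var n))
    (sym (shiftN-fuse 1 (c + k) 0 c _ (m≤m+n c k))) rvar
  varRepT-bumpN c k (rlam r)  = rlam (varRepT-bumpN c k r)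
  varRepT-bumpN c k (rappL r) = rappL (varRepT-bumpN c k r)
  varRepT-bumpN c k (rappR r) = rappR (varRepT-bumpN c k r)
  varRepT-bumpN c k (rmu r)   = rmu (varRepC-bumpN (suc c) k r)
  varRepT-bumpN c k (resL r)  = resL (varRepT-bumpN c k r)
  varRepT-bumpN c k (resR r)  = resR (varRepT-bumpN c k r)

  varRepC-bumpN : ∀ {u} c k {n A B} → VarRepC u n (c + k) A B →
    VarRepC u n (suc (c + k)) (shiftNC 1 c A) (shiftNC 1 c B)
  varRepC-bumpN c k (rnamed r) = rnamed (varRepT-bumpN c k r)
  varRepC-bumpN c k (rrsL r)   = rrsL (varRepC-bumpN (suc c) k r)
  varRepC-bumpN c k (rrsR r)   = rrsR (varRepT-bumpN c k r)

mutual
  nameRepT-bumpN : ∀ {g u} c k {m A B} → NameRepT g u (c + k) m A B →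
    NameRepT g u (suc (c + k)) m (shiftN 1 c A) (shiftN 1 c B)
  nameRepT-bumpN c k (nlam r)  = nlam (nameRepT-bumpN c k r)
  nameRepT-bumpN c k (nappL r) = nappL (nameRepT-bumpN c k r)
  nameRepT-bumpN c k (nappR r) = nappR (nameRepT-bumpN c k r)
  nameRepT-bumpN c k (nmu r)   = nmu (nameRepC-bumpN (suc c) k r)
  nameRepT-bumpN c k (nesL r)  = nesL (nameRepT-bumpN c k r)
  nameRepT-bumpN c k (nesR r)  = nesR (nameRepT-bumpN c k r)

  nameRepC-bumpN : ∀ {g u} c k {m A B} → NameRepC g u (c + k) m A B →
    NameRepC g u (suc (c + k)) m (shiftNC 1 c A) (shiftNC 1 c B)
  nameRepC-bumpN {g} {u} c k {m} (nhere {t = t}) = subst₂ (NameRepC g u (suc (c + k)) m)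
    (cong (λ z → named z (shiftN 1 c t)) (sym (shiftVar-≥ 1 c (c + k) (m≤m+n c k))))
    (cong₂ (λ z w → named z (app (shiftN 1 c t) w))
           (sym (shiftVar-≥ 1 c (c + k + suc g) (≤-trans (m≤m+n c k) (m≤m+n _ _))))
           (trans (cong (shiftT m 0) (sym (shiftN-fuse 1 (suc (c + k)) 0 c u (≤-trans (m≤m+n c k) (n≤1+n _)))))
                  (shiftT-shiftN m 0 1 c _)))
    nhere
  nameRepC-bumpN c k (nnamed r) = nnamed (nameRepT-bumpN c k r)
  nameRepC-bumpN c k (nrsL r)   = nrsL (nameRepC-bumpN (suc c) k r)
  nameRepC-bumpN c k (nrsR r)   = nrsR (nameRepT-bumpN c k r)

mutual
  nameRepT-bumpT : ∀ {g u} c k {n A B} → NameRepT g u n (c + k) A B →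
    NameRepT g u n (suc (c + k)) (shiftT 1 c A) (shiftT 1 c B)
  nameRepT-bumpT c k (nlam r)  = nlam (nameRepT-bumpT (suc c) k r)
  nameRepT-bumpT c k (nappL r) = nappL (nameRepT-bumpT c k r)
  nameRepT-bumpT c k (nappR r) = nappR (nameRepT-bumpT c k r)
  nameRepT-bumpT c k (nmu r)   = nmu (nameRepC-bumpT c k r)
  nameRepT-bumpT c k (nesL r)  = nesL (nameRepT-bumpT (suc c) k r)
  nameRepT-bumpT c k (nesR r)  = nesR (nameRepT-bumpT c k r)

  nameRepC-bumpT : ∀ {g u} c k {n A B} → NameRepC g u n (c + k) A B →
    NameRepC g u n (suc (c + k)) (shiftTC 1 c A) (shiftTC 1 c B)
  nameRepC-bumpT {g} {u} c k {n} (nhere {t = t}) = subst (NameRepC g u n (suc (c + k)) (named n (shiftT 1 c t)))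
    (cong (λ w → named (n + suc g) (app (shiftT 1 c t) w)) (sym (shiftT-fuse 1 (c + k) 0 c _ (m≤m+n c k))))
    nhere
  nameRepC-bumpT c k (nnamed r) = nnamed (nameRepT-bumpT c k r)
  nameRepC-bumpT c k (nrsL r)   = nrsL (nameRepC-bumpT c k r)
  nameRepC-bumpT c k (nrsR r)   = nrsR (nameRepT-bumpT c k r)

betaAt-bump : ∀ {u} c k {A B} → BetaAt u (c + k) A B → BetaAt u (suc (c + k)) (shiftT 1 c A) (shiftT 1 c B)
betaAt-bump {u} c k (bhere {t = t}) = subst (BetaAt u (suc (c + k)) (lam (shiftT 1 (suc c) t)))
  (cong (esub (shiftT 1 (suc c) t)) (sym (shiftT-fuse 1 (c + k) 0 c u (m≤m+n c k)))) bhere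
betaAt-bump c k (besub r) = besub (betaAt-bump (suc c) k r)

muAppAt-bump : ∀ {u} c k {A B} → MuAppAt u (c + k) A B → MuAppAt u (suc (c + k)) (shiftT 1 c A) (shiftT 1 c B)
muAppAt-bump {u} c k (mhere {c = x}) = subst (MuAppAt u (suc (c + k)) (mu (shiftTC 1 c x)))
  (cong₂ (λ p q → mu (rsub p 0 q)) (sym (shiftTC-shiftNC 1 c 1 1 x))
         (trans (cong (shiftN 1 0) (sym (shiftT-fuse 1 (c + k) 0 c u (m≤m+n c k)))) (sym (shiftT-shiftN 1 c 1 0 _))))
  mhere
muAppAt-bump c k (mesub r) = mesub (muAppAt-bump (suc c) k r)

shiftVar-beyond : ∀ n c g → shiftVar 1 (suc (n + c)) (n + suc g) ≡ n + suc (shiftVar 1 c g)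
shiftVar-beyond n c g with g <? c
... | yes g<c = trans (shiftVar-< 1 _ _ (s≤s (+-monoʳ-≤ n g<c))) (cong (λ z → n + suc z) (sym (shiftVar-< 1 c g g<c)))
... | no g≮c  = trans (shiftVar-≥ 1 _ _ (subst (suc (n + c) ≤_) (sym (+-suc n g)) (s≤s (+-monoʳ-≤ n (≮⇒≥ g≮c)))))
                      (trans (sym (+-suc n (suc g))) (cong (λ z → n + suc z) (sym (shiftVar-≥ 1 c g (≮⇒≥ g≮c)))))

mutual
  varRepT-shiftT : ∀ {u} c {n m A B} → VarRepT u n m A B →
    VarRepT (shiftT 1 c u) n m (shiftT 1 (suc (n + c)) A) (shiftT 1 (suc (n + c)) B)
  varRepT-shiftT {u} c {n} {m} rvar = subst₂ (VarRepT (shiftT 1 c u) n m)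
    (cong var (sym (shiftVar-< 1 _ n (s≤s (m≤m+n n c)))))
    (trans (cong (shiftN m 0) (sym (shiftT-comm 1 (suc n) 0 c u))) (sym (shiftT-shiftN 1 _ m 0 _)))
    rvar
  varRepT-shiftT c (rlam r)  = rlam (varRepT-shiftT c r)
  varRepT-shiftT c (rappL r) = rappL (varRepT-shiftT c r)
  varRepT-shiftT c (rappR r) = rappR (varRepT-shiftT c r)
  varRepT-shiftT c (rmu r)   = rmu (varRepC-shiftT c r)
  varRepT-shiftT c (resL r)  = resL (varRepT-shiftT c r)
  varRepT-shiftT c (resR r)  = resR (varRepT-shiftT c r)

  varRepC-shiftT : ∀ {u} c {n m A B} → VarRepC u n m A B →
    VarRepC (shiftT 1 c u) n m (shiftTC 1 (suc (n + c)) A) (shiftTC 1 (suc (n + c)) B)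
  varRepC-shiftT c (rnamed r) = rnamed (varRepT-shiftT c r)
  varRepC-shiftT c (rrsL r)   = rrsL (varRepC-shiftT c r)
  varRepC-shiftT c (rrsR r)   = rrsR (varRepT-shiftT c r)

mutual
  varRepT-shiftN : ∀ {u} c {n m A B} → VarRepT u n m A B →
    VarRepT (shiftN 1 c u) n m (shiftN 1 (m + c) A) (shiftN 1 (m + c) B)
  varRepT-shiftN {u} c {n} {m} rvar = subst (VarRepT (shiftN 1 c u) n m (var n))
    (sym (trans (shiftN-comm 1 m 0 c _) (cong (shiftN m 0) (sym (shiftT-shiftN (suc n) 0 1 c u))))) rvar
  varRepT-shiftN c (rlam r)  = rlam (varRepT-shiftN c r)
  varRepT-shiftN c (rappL r) = rappL (varRepT-shiftN c r)
  varRepT-shiftN c (rappR r) = rappR (varRepT-shiftN c r)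
  varRepT-shiftN c (rmu r)   = rmu (varRepC-shiftN c r)
  varRepT-shiftN c (resL r)  = resL (varRepT-shiftN c r)
  varRepT-shiftN c (resR r)  = resR (varRepT-shiftN c r)

  varRepC-shiftN : ∀ {u} c {n m A B} → VarRepC u n m A B →
    VarRepC (shiftN 1 c u) n m (shiftNC 1 (m + c) A) (shiftNC 1 (m + c) B)
  varRepC-shiftN c (rnamed r) = rnamed (varRepT-shiftN c r)
  varRepC-shiftN c (rrsL r)   = rrsL (varRepC-shiftN c r)
  varRepC-shiftN c (rrsR r)   = rrsR (varRepT-shiftN c r)

mutual
  nameRepT-shiftN : ∀ {g u} c {n m A B} → NameRepT g u n m A B →
    NameRepT (shiftVar 1 c g) (shiftN 1 c u) n m (shiftN 1 (suc (n + c)) A) (shiftN 1 (suc (n + c)) B)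
  nameRepT-shiftN c (nlam r)  = nlam (nameRepT-shiftN c r)
  nameRepT-shiftN c (nappL r) = nappL (nameRepT-shiftN c r)
  nameRepT-shiftN c (nappR r) = nappR (nameRepT-shiftN c r)
  nameRepT-shiftN c (nmu r)   = nmu (nameRepC-shiftN c r)
  nameRepT-shiftN c (nesL r)  = nesL (nameRepT-shiftN c r)
  nameRepT-shiftN c (nesR r)  = nesR (nameRepT-shiftN c r)

  nameRepC-shiftN : ∀ {g u} c {n m A B} → NameRepC g u n m A B →
    NameRepC (shiftVar 1 c g) (shiftN 1 c u) n m (shiftNC 1 (suc (n + c)) A) (shiftNC 1 (suc (n + c)) B)
  nameRepC-shiftN {g} {u} c {n} {m} (nhere {t = t}) = subst₂ (NameRepC (shiftVar 1 c g) (shiftN 1 c u) n m)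
    (cong (λ z → named z (shiftN 1 (suc (n + c)) t)) (sym (shiftVar-< 1 _ n (s≤s (m≤m+n n c)))))
    (cong₂ (λ z w → named z (app (shiftN 1 (suc (n + c)) t) w)) (sym (shiftVar-beyond n c g))
           (trans (cong (shiftT m 0) (sym (shiftN-comm 1 (suc n) 0 c u))) (shiftT-shiftN m 0 1 (suc (n + c)) _)))
    nhere
  nameRepC-shiftN c (nnamed r) = nnamed (nameRepT-shiftN c r)
  nameRepC-shiftN c (nrsL r)   = nrsL (nameRepC-shiftN c r)
  nameRepC-shiftN c (nrsR r)   = nrsR (nameRepT-shiftN c r)

mutual
  nameRepT-shiftT : ∀ {g u} c {n m A B} → NameRepT g u n m A B →
    NameRepT g (shiftT 1 c u) n m (shiftT 1 (m + c) A) (shiftT 1 (m + c) B)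
  nameRepT-shiftT c (nlam r)  = nlam (nameRepT-shiftT c r)
  nameRepT-shiftT c (nappL r) = nappL (nameRepT-shiftT c r)
  nameRepT-shiftT c (nappR r) = nappR (nameRepT-shiftT c r)
  nameRepT-shiftT c (nmu r)   = nmu (nameRepC-shiftT c r)
  nameRepT-shiftT c (nesL r)  = nesL (nameRepT-shiftT c r)
  nameRepT-shiftT c (nesR r)  = nesR (nameRepT-shiftT c r)

  nameRepC-shiftT : ∀ {g u} c {n m A B} → NameRepC g u n m A B →
    NameRepC g (shiftT 1 c u) n m (shiftTC 1 (m + c) A) (shiftTC 1 (m + c) B)
  nameRepC-shiftT {g} {u} c {n} {m} (nhere {t = t}) = subst (NameRepC g (shiftT 1 c u) n m (named n (shiftT 1 (m + c) t)))
    (cong (λ w → named (n + suc g) (app (shiftT 1 (m + c) t) w))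
          (sym (trans (shiftT-comm 1 m 0 c _) (cong (shiftT m 0) (shiftT-shiftN 1 c (suc n) 0 u)))))
    nhere
  nameRepC-shiftT c (nnamed r) = nnamed (nameRepT-shiftT c r)
  nameRepC-shiftT c (nrsL r)   = nrsL (nameRepC-shiftT c r)
  nameRepC-shiftT c (nrsR r)   = nrsR (nameRepT-shiftT c r)

betaAt-shiftT : ∀ {u} c {d A B} → BetaAt u d A B → BetaAt (shiftT 1 c u) d (shiftT 1 (d + c) A) (shiftT 1 (d + c) B)
betaAt-shiftT {u} c {d} (bhere {t = t}) = subst (BetaAt (shiftT 1 c u) d (lam (shiftT 1 (suc (d + c)) t)))
  (cong (esub _) (sym (shiftT-comm 1 d 0 c u))) bhere
betaAt-shiftT c (besub r) = besub (betaAt-shiftT c r)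

betaAt-shiftN : ∀ {u} c {d A B} → BetaAt u d A B → BetaAt (shiftN 1 c u) d (shiftN 1 c A) (shiftN 1 c B)
betaAt-shiftN {u} c {d} (bhere {t = t}) = subst (BetaAt (shiftN 1 c u) d (lam (shiftN 1 c t)))
  (cong (esub _) (shiftT-shiftN d 0 1 c u)) bhere
betaAt-shiftN c (besub r) = besub (betaAt-shiftN c r)

muAppAt-shiftT : ∀ {u} c {d A B} → MuAppAt u d A B → MuAppAt (shiftT 1 c u) d (shiftT 1 (d + c) A) (shiftT 1 (d + c) B)
muAppAt-shiftT {u} c {d} (mhere {c = x}) = subst (MuAppAt (shiftT 1 c u) d (mu (shiftTC 1 (d + c) x)))
  (cong₂ (λ p q → mu (rsub p 0 q)) (sym (shiftTC-shiftNC 1 (d + c) 1 1 x))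
         (trans (cong (shiftN 1 0) (sym (shiftT-comm 1 d 0 c u))) (sym (shiftT-shiftN 1 (d + c) 1 0 _))))
  mhere
muAppAt-shiftT c (mesub r) = mesub (muAppAt-shiftT c r)

muAppAt-shiftN : ∀ {u} c {d A B} → MuAppAt u d A B → MuAppAt (shiftN 1 c u) d (shiftN 1 c A) (shiftN 1 c B)
muAppAt-shiftN {u} c {d} (mhere {c = x}) = subst (MuAppAt (shiftN 1 c u) d (mu (shiftNC 1 (suc c) x)))
  (cong₂ (λ p q → mu (rsub p 0 q)) (sym (shiftNC-comm 1 1 1 c x))
         (trans (cong (shiftN 1 0) (shiftT-shiftN d 0 1 c u)) (sym (shiftN-comm 1 1 0 c _))))
  mhere
muAppAt-shiftN c (mesub r) = mesub (muAppAt-shiftN c r)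

redexT-shiftT : ∀ c {a b} → RedexT a b → RedexT (shiftT 1 c a) (shiftT 1 c b)
redexT-shiftT c (redB br)                 = redB (betaAt-shiftT c br)
redexT-shiftT c (redM mr)                 = redM (muAppAt-shiftT c mr)
redexT-shiftT c (redCv {A = A} r h)       = redCv (varRepT-shiftT c r) (subst (1 <_) (sym (countT-shift-< 0 (suc c) A z<s)) h)
redexT-shiftT c (redDv {A = A} {r = x} r h e) = redDv (varRepT-shiftT c r) (trans (countT-shift-< 0 (suc c) A z<s) h)
  (trans (sym (shiftT-comm 1 1 0 c x)) (cong (shiftT 1 (suc c)) e))

redexT-shiftN : ∀ c {a b} → RedexT a b → RedexT (shiftN 1 c a) (shiftN 1 c b)
redexT-shiftN c (redB br)                 = redB (betaAt-shiftN c br)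
redexT-shiftN c (redM mr)                 = redM (muAppAt-shiftN c mr)
redexT-shiftN c (redCv {A = A} r h)       = redCv (varRepT-shiftN c r) (subst (1 <_) (sym (countT-shiftN 1 0 c A)) h)
redexT-shiftN c (redDv {A = A} {r = x} r h e) = redDv (varRepT-shiftN c r) (trans (countT-shiftN 1 0 c A) h)
  (trans (shiftT-shiftN 1 0 1 c x) (cong (shiftN 1 c) e))

redexC-shiftN : ∀ c {a b} → RedexC a b → RedexC (shiftNC 1 c a) (shiftNC 1 c b)
redexC-shiftN c (redCn {c = A} r h)       = redCn (nameRepC-shiftN c r) (subst (1 <_) (sym (countNC-shift-< 0 (suc c) A z<s)) h)
redexC-shiftN c (redDn {c = A} {r = x} r h e) = redDn (nameRepC-shiftN c r) (trans (countNC-shift-< 0 (suc c) A z<s) h)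
  (trans (sym (shiftNC-comm 1 1 0 c x)) (cong (shiftNC 1 (suc c)) e))

redexC-shiftT : ∀ c {a b} → RedexC a b → RedexC (shiftTC 1 c a) (shiftTC 1 c b)
redexC-shiftT c (redCn {c = A} r h)       = redCn (nameRepC-shiftT c r) (subst (1 <_) (sym (countNC-shiftTC 1 0 c A)) h)
redexC-shiftT c (redDn {c = A} {r = x} r h e) = redDn (nameRepC-shiftT c r) (trans (countNC-shiftTC 1 0 c A) h)
  (trans (sym (shiftTC-shiftNC 1 c 1 0 x)) (cong (shiftTC 1 c) e))

weakT-shiftT : ∀ c {a b} → RootWT a b → RootWT (shiftT 1 c a) (shiftT 1 c b)
weakT-shiftT c (ruleWv t u) = subst (λ z → RootWT (esub z (shiftT 1 c u)) (shiftT 1 c t))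
  (sym (shiftT-comm 1 1 0 c t)) (ruleWv (shiftT 1 c t) (shiftT 1 c u))

weakT-shiftN : ∀ c {a b} → RootWT a b → RootWT (shiftN 1 c a) (shiftN 1 c b)
weakT-shiftN c (ruleWv t u) = subst (λ z → RootWT (esub z (shiftN 1 c u)) (shiftN 1 c t))
  (shiftT-shiftN 1 0 1 c t) (ruleWv (shiftN 1 c t) (shiftN 1 c u))

weakC-shiftN : ∀ c {a b} → RootWC a b → RootWC (shiftNC 1 c a) (shiftNC 1 c b)
weakC-shiftN c (ruleWn x γ u) = subst (λ z → RootWC (rsub z (shiftVar 1 c γ) (shiftN 1 c u)) (shiftNC 1 c x))
  (sym (shiftNC-comm 1 1 0 c x)) (ruleWn (shiftNC 1 c x) _ _)

weakC-shiftT : ∀ c {a b} → RootWC a b → RootWC (shiftTC 1 c a) (shiftTC 1 c b)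
weakC-shiftT c (ruleWn x γ u) = subst (λ z → RootWC (rsub z γ (shiftT 1 c u)) (shiftTC 1 c x))
  (sym (shiftTC-shiftNC 1 c 1 0 x)) (ruleWn (shiftTC 1 c x) _ _)

module ShiftStable {R : Tm → Tm → Set} {S : Cmd → Cmd → Set}
  (R-shiftT : ∀ c {a b} → R a b → R (shiftT 1 c a) (shiftT 1 c b))
  (S-shiftT : ∀ c {a b} → S a b → S (shiftTC 1 c a) (shiftTC 1 c b))
  (R-shiftN : ∀ c {a b} → R a b → R (shiftN 1 c a) (shiftN 1 c b))
  (S-shiftN : ∀ c {a b} → S a b → S (shiftNC 1 c a) (shiftNC 1 c b)) where
  mutual
    stepT-shiftT : ∀ c {a b} → StepT R S a b → StepT R S (shiftT 1 c a) (shiftT 1 c b)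
    stepT-shiftT c (root x) = root (R-shiftT c x)
    stepT-shiftT c (lamS s) = lamS (stepT-shiftT (suc c) s)
    stepT-shiftT c (appL s) = appL (stepT-shiftT c s)
    stepT-shiftT c (appR s) = appR (stepT-shiftT c s)
    stepT-shiftT c (muS s)  = muS (stepC-shiftT c s)
    stepT-shiftT c (esL s)  = esL (stepT-shiftT (suc c) s)
    stepT-shiftT c (esR s)  = esR (stepT-shiftT c s)

    stepC-shiftT : ∀ c {a b} → StepC R S a b → StepC R S (shiftTC 1 c a) (shiftTC 1 c b)
    stepC-shiftT c (root x)   = root (S-shiftT c x)
    stepC-shiftT c (namedS s) = namedS (stepT-shiftT c s)
    stepC-shiftT c (rsL s)    = rsL (stepC-shiftT c s)
    stepC-shiftT c (rsR s)    = rsR (stepT-shiftT c s)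

  mutual
    stepT-shiftN : ∀ c {a b} → StepT R S a b → StepT R S (shiftN 1 c a) (shiftN 1 c b)
    stepT-shiftN c (root x) = root (R-shiftN c x)
    stepT-shiftN c (lamS s) = lamS (stepT-shiftN c s)
    stepT-shiftN c (appL s) = appL (stepT-shiftN c s)
    stepT-shiftN c (appR s) = appR (stepT-shiftN c s)
    stepT-shiftN c (muS s)  = muS (stepC-shiftN (suc c) s)
    stepT-shiftN c (esL s)  = esL (stepT-shiftN c s)
    stepT-shiftN c (esR s)  = esR (stepT-shiftN c s)

    stepC-shiftN : ∀ c {a b} → StepC R S a b → StepC R S (shiftNC 1 c a) (shiftNC 1 c b)
    stepC-shiftN c (root x)   = root (S-shiftN c x)
    stepC-shiftN c (namedS s) = namedS (stepT-shiftN c s)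
    stepC-shiftN c (rsL s)    = rsL (stepC-shiftN (suc c) s)
    stepC-shiftN c (rsR s)    = rsR (stepT-shiftN c s)

RedStepT : Tm → Tm → Set
RedStepT = StepT RedexT RedexC

RedStepC : Cmd → Cmd → Set
RedStepC = StepC RedexT RedexC

WeakStepT : Tm → Tm → Set
WeakStepT = StepT RootWT RootWC

WeakStepC : Cmd → Cmd → Set
WeakStepC = StepC RootWT RootWC

module RedShift  = ShiftStable redexT-shiftT redexC-shiftT redexT-shiftN redexC-shiftN
module WeakShift = ShiftStable weakT-shiftT weakC-shiftT weakT-shiftN weakC-shiftN

-- o ⊳T p: p is obtained from o by deleting, anywhere inside o, explicit
-- substitutions t[x/w] with x ∉ fv(t) and replacements c⟨α//γ.w⟩ with α ∉ fn(c);
-- the remainder of the deleted node is itself erased.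

infix 4 _⊳T_ _⊳C_

mutual
  data _⊳T_ : Tm → Tm → Set where
    evar  : ∀ {i} → var i ⊳T var i
    elam  : ∀ {t t'} → t ⊳T t' → lam t ⊳T lam t'
    eapp  : ∀ {t t' u u'} → t ⊳T t' → u ⊳T u' → app t u ⊳T app t' u'
    emu   : ∀ {c c'} → c ⊳C c' → mu c ⊳T mu c'
    eesub : ∀ {t t' u u'} → t ⊳T t' → u ⊳T u' → esub t u ⊳T esub t' u'
    edrop : ∀ {t w p} → t ⊳T shiftT 1 0 p → esub t w ⊳T p

  data _⊳C_ : Cmd → Cmd → Set where
    enamed : ∀ {a t t'} → t ⊳T t' → named a t ⊳C named a t'
    ersub  : ∀ {c c' b u u'} → c ⊳C c' → u ⊳T u' → rsub c b u ⊳C rsub c' b u'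
    edropC : ∀ {c b w d} → c ⊳C shiftNC 1 0 d → rsub c b w ⊳C d

mutual
  ⊳T-refl : ∀ t → t ⊳T t
  ⊳T-refl (var i)    = evar
  ⊳T-refl (lam t)    = elam (⊳T-refl t)
  ⊳T-refl (app t u)  = eapp (⊳T-refl t) (⊳T-refl u)
  ⊳T-refl (mu c)     = emu (⊳C-refl c)
  ⊳T-refl (esub t u) = eesub (⊳T-refl t) (⊳T-refl u)

  ⊳C-refl : ∀ c → c ⊳C c
  ⊳C-refl (named a t)  = enamed (⊳T-refl t)
  ⊳C-refl (rsub c b u) = ersub (⊳C-refl c) (⊳T-refl u)

mutual
  ⊳T-shiftT : ∀ d c {a b} → a ⊳T b → shiftT d c a ⊳T shiftT d c b
  ⊳T-shiftT d c evar          = evar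
  ⊳T-shiftT d c (elam e)      = elam (⊳T-shiftT d (suc c) e)
  ⊳T-shiftT d c (eapp e e')   = eapp (⊳T-shiftT d c e) (⊳T-shiftT d c e')
  ⊳T-shiftT d c (emu e)       = emu (⊳C-shiftTC d c e)
  ⊳T-shiftT d c (eesub e e')  = eesub (⊳T-shiftT d (suc c) e) (⊳T-shiftT d c e')
  ⊳T-shiftT d c (edrop {p = p} e) = edrop (subst (_ ⊳T_) (shiftT-comm d 1 0 c p) (⊳T-shiftT d (suc c) e))

  ⊳C-shiftTC : ∀ d c {a b} → a ⊳C b → shiftTC d c a ⊳C shiftTC d c b
  ⊳C-shiftTC d c (enamed e)   = enamed (⊳T-shiftT d c e)
  ⊳C-shiftTC d c (ersub e e') = ersub (⊳C-shiftTC d c e) (⊳T-shiftT d c e')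
  ⊳C-shiftTC d c (edropC {d = x} e) = edropC (subst (_ ⊳C_) (shiftTC-shiftNC d c 1 0 x) (⊳C-shiftTC d c e))

mutual
  ⊳T-shiftN : ∀ d c {a b} → a ⊳T b → shiftN d c a ⊳T shiftN d c b
  ⊳T-shiftN d c evar          = evar
  ⊳T-shiftN d c (elam e)      = elam (⊳T-shiftN d c e)
  ⊳T-shiftN d c (eapp e e')   = eapp (⊳T-shiftN d c e) (⊳T-shiftN d c e')
  ⊳T-shiftN d c (emu e)       = emu (⊳C-shiftNC d (suc c) e)
  ⊳T-shiftN d c (eesub e e')  = eesub (⊳T-shiftN d c e) (⊳T-shiftN d c e')
  ⊳T-shiftN d c (edrop {p = p} e) = edrop (subst (_ ⊳T_) (sym (shiftT-shiftN 1 0 d c p)) (⊳T-shiftN d c e))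

  ⊳C-shiftNC : ∀ d c {a b} → a ⊳C b → shiftNC d c a ⊳C shiftNC d c b
  ⊳C-shiftNC d c (enamed e)   = enamed (⊳T-shiftN d c e)
  ⊳C-shiftNC d c (ersub e e') = ersub (⊳C-shiftNC d (suc c) e) (⊳T-shiftN d c e')
  ⊳C-shiftNC d c (edropC {d = x} e) = edropC (subst (_ ⊳C_) (shiftNC-comm d 1 0 c x) (⊳C-shiftNC d (suc c) e))

mutual
  ⊳T-countT : ∀ k {a b} → a ⊳T b → countT k b ≤ countT k a
  ⊳T-countT k evar          = ≤-refl
  ⊳T-countT k (elam e)      = ⊳T-countT (suc k) e
  ⊳T-countT k (eapp e e')   = +-mono-≤ (⊳T-countT k e) (⊳T-countT k e')
  ⊳T-countT k (emu e)       = ⊳C-countTC k e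
  ⊳T-countT k (eesub e e')  = +-mono-≤ (⊳T-countT (suc k) e) (⊳T-countT k e')
  ⊳T-countT k (edrop {p = p} e) =
    ≤-trans (≤-reflexive (sym (countT-shift-≥ k 0 p z≤n))) (≤-trans (⊳T-countT (suc k) e) (m≤m+n _ _))

  ⊳C-countTC : ∀ k {a b} → a ⊳C b → countTC k b ≤ countTC k a
  ⊳C-countTC k (enamed e)   = ⊳T-countT k e
  ⊳C-countTC k (ersub e e') = +-mono-≤ (⊳C-countTC k e) (⊳T-countT k e')
  ⊳C-countTC k (edropC {d = x} e) =
    ≤-trans (≤-reflexive (sym (countTC-shiftNC 1 k 0 x))) (≤-trans (⊳C-countTC k e) (m≤m+n _ _))

mutual
  ⊳T-countN : ∀ k {a b} → a ⊳T b → countN k b ≤ countN k a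
  ⊳T-countN k evar          = ≤-refl
  ⊳T-countN k (elam e)      = ⊳T-countN k e
  ⊳T-countN k (eapp e e')   = +-mono-≤ (⊳T-countN k e) (⊳T-countN k e')
  ⊳T-countN k (emu e)       = ⊳C-countNC (suc k) e
  ⊳T-countN k (eesub e e')  = +-mono-≤ (⊳T-countN k e) (⊳T-countN k e')
  ⊳T-countN k (edrop {p = p} e) =
    ≤-trans (≤-reflexive (sym (countN-shiftT 1 k 0 p))) (≤-trans (⊳T-countN k e) (m≤m+n _ _))

  ⊳C-countNC : ∀ k {a b} → a ⊳C b → countNC k b ≤ countNC k a
  ⊳C-countNC k (enamed {a = a} e)   = +-monoʳ-≤ (eqCount a k) (⊳T-countN k e)
  ⊳C-countNC k (ersub {b = b} e e') = +-mono-≤ (+-monoˡ-≤ (eqCount b k) (⊳C-countNC (suc k) e)) (⊳T-countN k e')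
  ⊳C-countNC k (edropC {d = x} e) =
    ≤-trans (≤-reflexive (sym (countNC-shift-≥ k 0 x z≤n)))
            (≤-trans (⊳C-countNC (suc k) e) (≤-trans (m≤m+n _ _) (m≤m+n _ _)))

shiftT-inv-var : ∀ c b {i} → var i ≡ shiftT 1 c b → Σ ℕ λ k → (b ≡ var k) × (i ≡ shiftVar 1 c k)
shiftT-inv-var c (var k) refl = k , refl , refl

shiftT-inv-lam : ∀ c b {s} → lam s ≡ shiftT 1 c b → Σ Tm λ b₁ → (b ≡ lam b₁) × (s ≡ shiftT 1 (suc c) b₁)
shiftT-inv-lam c (lam b₁) refl = b₁ , refl , refl

shiftT-inv-app : ∀ c b {s s'} → app s s' ≡ shiftT 1 c b →
  Σ Tm λ b₁ → Σ Tm λ b₂ → (b ≡ app b₁ b₂) × (s ≡ shiftT 1 c b₁) × (s' ≡ shiftT 1 c b₂)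
shiftT-inv-app c (app b₁ b₂) refl = b₁ , b₂ , refl , refl , refl

shiftT-inv-mu : ∀ c b {s} → mu s ≡ shiftT 1 c b → Σ Cmd λ b₁ → (b ≡ mu b₁) × (s ≡ shiftTC 1 c b₁)
shiftT-inv-mu c (mu b₁) refl = b₁ , refl , refl

shiftT-inv-esub : ∀ c b {s s'} → esub s s' ≡ shiftT 1 c b →
  Σ Tm λ b₁ → Σ Tm λ b₂ → (b ≡ esub b₁ b₂) × (s ≡ shiftT 1 (suc c) b₁) × (s' ≡ shiftT 1 c b₂)
shiftT-inv-esub c (esub b₁ b₂) refl = b₁ , b₂ , refl , refl , refl

shiftTC-inv-named : ∀ c b {a s} → named a s ≡ shiftTC 1 c b → Σ Tm λ b₁ → (b ≡ named a b₁) × (s ≡ shiftT 1 c b₁)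
shiftTC-inv-named c (named a b₁) refl = b₁ , refl , refl

shiftTC-inv-rsub : ∀ c b {x g s} → rsub x g s ≡ shiftTC 1 c b →
  Σ Cmd λ b₁ → Σ Tm λ b₂ → (b ≡ rsub b₁ g b₂) × (x ≡ shiftTC 1 c b₁) × (s ≡ shiftT 1 c b₂)
shiftTC-inv-rsub c (rsub b₁ g b₂) refl = b₁ , b₂ , refl , refl , refl

shiftN-inv-var : ∀ c b {i} → var i ≡ shiftN 1 c b → b ≡ var i
shiftN-inv-var c (var k) refl = refl

shiftN-inv-lam : ∀ c b {s} → lam s ≡ shiftN 1 c b → Σ Tm λ b₁ → (b ≡ lam b₁) × (s ≡ shiftN 1 c b₁)
shiftN-inv-lam c (lam b₁) refl = b₁ , refl , refl

shiftN-inv-app : ∀ c b {s s'} → app s s' ≡ shiftN 1 c b →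
  Σ Tm λ b₁ → Σ Tm λ b₂ → (b ≡ app b₁ b₂) × (s ≡ shiftN 1 c b₁) × (s' ≡ shiftN 1 c b₂)
shiftN-inv-app c (app b₁ b₂) refl = b₁ , b₂ , refl , refl , refl

shiftN-inv-mu : ∀ c b {s} → mu s ≡ shiftN 1 c b → Σ Cmd λ b₁ → (b ≡ mu b₁) × (s ≡ shiftNC 1 (suc c) b₁)
shiftN-inv-mu c (mu b₁) refl = b₁ , refl , refl

shiftN-inv-esub : ∀ c b {s s'} → esub s s' ≡ shiftN 1 c b →
  Σ Tm λ b₁ → Σ Tm λ b₂ → (b ≡ esub b₁ b₂) × (s ≡ shiftN 1 c b₁) × (s' ≡ shiftN 1 c b₂)
shiftN-inv-esub c (esub b₁ b₂) refl = b₁ , b₂ , refl , refl , refl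

shiftNC-inv-named : ∀ c b {a s} → named a s ≡ shiftNC 1 c b →
  Σ ℕ λ k → Σ Tm λ b₁ → (b ≡ named k b₁) × (a ≡ shiftVar 1 c k) × (s ≡ shiftN 1 c b₁)
shiftNC-inv-named c (named k b₁) refl = k , b₁ , refl , refl , refl

shiftNC-inv-rsub : ∀ c b {x g s} → rsub x g s ≡ shiftNC 1 c b →
  Σ Cmd λ b₁ → Σ ℕ λ k → Σ Tm λ b₂ →
    (b ≡ rsub b₁ k b₂) × (x ≡ shiftNC 1 (suc c) b₁) × (g ≡ shiftVar 1 c k) × (s ≡ shiftN 1 c b₂)
shiftNC-inv-rsub c (rsub b₁ k b₂) refl = b₁ , k , b₂ , refl , refl , refl , refl

-- Erasure between two weakenings is an erasure between the originals
-- (the second weakening is given as an equation to allow induction).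
mutual
  ⊳T-unshiftT : ∀ c a {b'} b → shiftT 1 c a ⊳T b' → b' ≡ shiftT 1 c b → a ⊳T b
  ⊳T-unshiftT c (var i) b evar e₂ with shiftT-inv-var c b e₂
  ... | k , refl , e = subst (λ z → var i ⊳T var z) (shiftVar-injective c i k e) evar
  ⊳T-unshiftT c (lam a) b (elam e) e₂ with shiftT-inv-lam c b e₂
  ... | b₁ , refl , refl = elam (⊳T-unshiftT (suc c) a b₁ e refl)
  ⊳T-unshiftT c (app a a') b (eapp e e') e₂ with shiftT-inv-app c b e₂
  ... | b₁ , b₂ , refl , refl , refl = eapp (⊳T-unshiftT c a b₁ e refl) (⊳T-unshiftT c a' b₂ e' refl)
  ⊳T-unshiftT c (mu x) b (emu e) e₂ with shiftT-inv-mu c b e₂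
  ... | b₁ , refl , refl = emu (⊳C-unshiftTC c x b₁ e refl)
  ⊳T-unshiftT c (esub a a') b (eesub e e') e₂ with shiftT-inv-esub c b e₂
  ... | b₁ , b₂ , refl , refl , refl = eesub (⊳T-unshiftT (suc c) a b₁ e refl) (⊳T-unshiftT c a' b₂ e' refl)
  ⊳T-unshiftT c (esub a a') b (edrop e) refl = edrop (⊳T-unshiftT (suc c) a (shiftT 1 0 b) e (sym (shiftT-comm 1 1 0 c b)))

  ⊳C-unshiftTC : ∀ c a {b'} b → shiftTC 1 c a ⊳C b' → b' ≡ shiftTC 1 c b → a ⊳C b
  ⊳C-unshiftTC c (named n t) b (enamed e) e₂ with shiftTC-inv-named c b e₂
  ... | b₁ , refl , refl = enamed (⊳T-unshiftT c t b₁ e refl)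
  ⊳C-unshiftTC c (rsub x g w) b (ersub e e') e₂ with shiftTC-inv-rsub c b e₂
  ... | b₁ , b₂ , refl , refl , refl = ersub (⊳C-unshiftTC c x b₁ e refl) (⊳T-unshiftT c w b₂ e' refl)
  ⊳C-unshiftTC c (rsub x g w) b (edropC e) refl = edropC (⊳C-unshiftTC c x (shiftNC 1 0 b) e (sym (shiftTC-shiftNC 1 c 1 0 b)))

mutual
  ⊳T-unshiftN : ∀ c a {b'} b → shiftN 1 c a ⊳T b' → b' ≡ shiftN 1 c b → a ⊳T b
  ⊳T-unshiftN c (var i) b evar e₂ with shiftN-inv-var c b e₂
  ... | refl = evar
  ⊳T-unshiftN c (lam a) b (elam e) e₂ with shiftN-inv-lam c b e₂
  ... | b₁ , refl , refl = elam (⊳T-unshiftN c a b₁ e refl)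
  ⊳T-unshiftN c (app a a') b (eapp e e') e₂ with shiftN-inv-app c b e₂
  ... | b₁ , b₂ , refl , refl , refl = eapp (⊳T-unshiftN c a b₁ e refl) (⊳T-unshiftN c a' b₂ e' refl)
  ⊳T-unshiftN c (mu x) b (emu e) e₂ with shiftN-inv-mu c b e₂
  ... | b₁ , refl , refl = emu (⊳C-unshiftNC (suc c) x b₁ e refl)
  ⊳T-unshiftN c (esub a a') b (eesub e e') e₂ with shiftN-inv-esub c b e₂
  ... | b₁ , b₂ , refl , refl , refl = eesub (⊳T-unshiftN c a b₁ e refl) (⊳T-unshiftN c a' b₂ e' refl)
  ⊳T-unshiftN c (esub a a') b (edrop e) refl = edrop (⊳T-unshiftN c a (shiftT 1 0 b) e (shiftT-shiftN 1 0 1 c b))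

  ⊳C-unshiftNC : ∀ c a {b'} b → shiftNC 1 c a ⊳C b' → b' ≡ shiftNC 1 c b → a ⊳C b
  ⊳C-unshiftNC c (named n t) b (enamed e) e₂ with shiftNC-inv-named c b e₂
  ... | k , b₁ , refl , e₃ , refl =
    subst (λ z → named n t ⊳C named z b₁) (shiftVar-injective c n k e₃) (enamed (⊳T-unshiftN c t b₁ e refl))
  ⊳C-unshiftNC c (rsub x g w) b (ersub e e') e₂ with shiftNC-inv-rsub c b e₂
  ... | b₁ , k , b₂ , refl , refl , e₃ , refl =
    subst (λ z → rsub x g w ⊳C rsub b₁ z b₂) (shiftVar-injective c g k e₃)
          (ersub (⊳C-unshiftNC (suc c) x b₁ e refl) (⊳T-unshiftN c w b₂ e' refl))
  ⊳C-unshiftNC c (rsub x g w) b (edropC e) refl = edropC (⊳C-unshiftNC (suc c) x (shiftNC 1 0 b) e (sym (shiftNC-comm 1 1 0 c b)))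

mutual
  varRepT-lift : ∀ {u w n m X A B} → X ⊳T A → VarRepT u n m A B → w ⊳T u →
    Σ Tm λ X' → VarRepT w n m X X' × X' ⊳T B
  varRepT-lift {n = n} {m} evar rvar w⊳u = _ , rvar , ⊳T-shiftN m 0 (⊳T-shiftT (suc n) 0 w⊳u)
  varRepT-lift (elam e) (rlam r) w⊳u with varRepT-lift e r w⊳u
  ... | X' , r' , e' = _ , rlam r' , elam e'
  varRepT-lift (eapp e e₂) (rappL r) w⊳u with varRepT-lift e r w⊳u
  ... | X' , r' , e' = _ , rappL r' , eapp e' e₂
  varRepT-lift (eapp e₁ e) (rappR r) w⊳u with varRepT-lift e r w⊳u
  ... | X' , r' , e' = _ , rappR r' , eapp e₁ e'
  varRepT-lift (emu e) (rmu r) w⊳u with varRepC-lift e r w⊳u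
  ... | X' , r' , e' = _ , rmu r' , emu e'
  varRepT-lift (eesub e e₂) (resL r) w⊳u with varRepT-lift e r w⊳u
  ... | X' , r' , e' = _ , resL r' , eesub e' e₂
  varRepT-lift (eesub e₁ e) (resR r) w⊳u with varRepT-lift e r w⊳u
  ... | X' , r' , e' = _ , resR r' , eesub e₁ e'
  varRepT-lift {n = n} (edrop e) r w⊳u with varRepT-lift e (varRepT-bumpT 0 n r) w⊳u
  ... | X' , r' , e' = _ , resL r' , edrop e'

  varRepC-lift : ∀ {u w n m X A B} → X ⊳C A → VarRepC u n m A B → w ⊳T u →
    Σ Cmd λ X' → VarRepC w n m X X' × X' ⊳C B
  varRepC-lift (enamed e) (rnamed r) w⊳u with varRepT-lift e r w⊳u
  ... | X' , r' , e' = _ , rnamed r' , enamed e'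
  varRepC-lift (ersub e e₂) (rrsL r) w⊳u with varRepC-lift e r w⊳u
  ... | X' , r' , e' = _ , rrsL r' , ersub e' e₂
  varRepC-lift (ersub e₁ e) (rrsR r) w⊳u with varRepT-lift e r w⊳u
  ... | X' , r' , e' = _ , rrsR r' , ersub e₁ e'
  varRepC-lift {m = m} (edropC e) r w⊳u with varRepC-lift e (varRepC-bumpN 0 m r) w⊳u
  ... | X' , r' , e' = _ , rrsL r' , edropC e'

mutual
  nameRepT-lift : ∀ {g u w n m X A B} → X ⊳T A → NameRepT g u n m A B → w ⊳T u →
    Σ Tm λ X' → NameRepT g w n m X X' × X' ⊳T B
  nameRepT-lift (elam e) (nlam r) w⊳u with nameRepT-lift e r w⊳u
  ... | X' , r' , e' = _ , nlam r' , elam e'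
  nameRepT-lift (eapp e e₂) (nappL r) w⊳u with nameRepT-lift e r w⊳u
  ... | X' , r' , e' = _ , nappL r' , eapp e' e₂
  nameRepT-lift (eapp e₁ e) (nappR r) w⊳u with nameRepT-lift e r w⊳u
  ... | X' , r' , e' = _ , nappR r' , eapp e₁ e'
  nameRepT-lift (emu e) (nmu r) w⊳u with nameRepC-lift e r w⊳u
  ... | X' , r' , e' = _ , nmu r' , emu e'
  nameRepT-lift (eesub e e₂) (nesL r) w⊳u with nameRepT-lift e r w⊳u
  ... | X' , r' , e' = _ , nesL r' , eesub e' e₂
  nameRepT-lift (eesub e₁ e) (nesR r) w⊳u with nameRepT-lift e r w⊳u
  ... | X' , r' , e' = _ , nesR r' , eesub e₁ e'
  nameRepT-lift {m = m} (edrop e) r w⊳u with nameRepT-lift e (nameRepT-bumpT 0 m r) w⊳u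
  ... | X' , r' , e' = _ , nesL r' , edrop e'

  nameRepC-lift : ∀ {g u w n m X A B} → X ⊳C A → NameRepC g u n m A B → w ⊳T u →
    Σ Cmd λ X' → NameRepC g w n m X X' × X' ⊳C B
  nameRepC-lift {n = n} {m} (enamed e) nhere w⊳u = _ , nhere , enamed (eapp e (⊳T-shiftT m 0 (⊳T-shiftN (suc n) 0 w⊳u)))
  nameRepC-lift (enamed e) (nnamed r) w⊳u with nameRepT-lift e r w⊳u
  ... | X' , r' , e' = _ , nnamed r' , enamed e'
  nameRepC-lift (ersub e e₂) (nrsL r) w⊳u with nameRepC-lift e r w⊳u
  ... | X' , r' , e' = _ , nrsL r' , ersub e' e₂
  nameRepC-lift (ersub e₁ e) (nrsR r) w⊳u with nameRepT-lift e r w⊳u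
  ... | X' , r' , e' = _ , nrsR r' , ersub e₁ e'
  nameRepC-lift {n = n} (edropC e) r w⊳u with nameRepC-lift e (nameRepC-bumpN 0 n r) w⊳u
  ... | X' , r' , e' = _ , nrsL r' , edropC e'

betaAt-lift : ∀ {u w d X A B} → X ⊳T A → BetaAt u d A B → w ⊳T u → Σ Tm λ X' → BetaAt w d X X' × X' ⊳T B
betaAt-lift {d = d} (elam e) bhere w⊳u = _ , bhere , eesub e (⊳T-shiftT d 0 w⊳u)
betaAt-lift (eesub e e₂) (besub r) w⊳u with betaAt-lift e r w⊳u
... | X' , r' , e' = _ , besub r' , eesub e' e₂
betaAt-lift {d = d} (edrop e) r w⊳u with betaAt-lift e (betaAt-bump 0 d r) w⊳u
... | X' , r' , e' = _ , besub r' , edrop e'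

muAppAt-lift : ∀ {u w d X A B} → X ⊳T A → MuAppAt u d A B → w ⊳T u → Σ Tm λ X' → MuAppAt w d X X' × X' ⊳T B
muAppAt-lift {d = d} (emu e) mhere w⊳u = _ , mhere , emu (ersub (⊳C-shiftNC 1 1 e) (⊳T-shiftN 1 0 (⊳T-shiftT d 0 w⊳u)))
muAppAt-lift (eesub e e₂) (mesub r) w⊳u with muAppAt-lift e r w⊳u
... | X' , r' , e' = _ , mesub r' , eesub e' e₂
muAppAt-lift {d = d} (edrop e) r w⊳u with muAppAt-lift e (muAppAt-bump 0 d r) w⊳u
... | X' , r' , e' = _ , mesub r' , edrop e'

suc-+ʳ : ∀ a b c → suc b ≡ c → suc (a + b) ≡ a + c
suc-+ʳ a b c e = trans (sym (+-suc a b)) (cong (a +_) e)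

mutual
  varRepT-count : ∀ {u n m A B} → VarRepT u n m A B → suc (countT n B) ≡ countT n A
  varRepT-count {u} {n} {m} rvar = trans
    (cong suc (trans (countT-shiftN m n 0 (shiftT (suc n) 0 u)) (countT-shift-gap (suc n) n 0 u z≤n (s≤s (m≤m+n n 0)))))
    (sym (eqCount-same n))
  varRepT-count (rlam r)                  = varRepT-count r
  varRepT-count (rappL {s = s} r)         = cong (_+ countT _ s) (varRepT-count r)
  varRepT-count (rappR {t = t} r)         = suc-+ʳ (countT _ t) _ _ (varRepT-count r)
  varRepT-count (rmu r)                   = varRepC-count r
  varRepT-count (resL {s = s} r)          = cong (_+ countT _ s) (varRepT-count r)
  varRepT-count (resR {n = n} {t = t} r)  = suc-+ʳ (countT (suc n) t) _ _ (varRepT-count r)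

  varRepC-count : ∀ {u n m A B} → VarRepC u n m A B → suc (countTC n B) ≡ countTC n A
  varRepC-count (rnamed r)                = varRepT-count r
  varRepC-count (rrsL {s = s} r)          = cong (_+ countT _ s) (varRepC-count r)
  varRepC-count (rrsR {n = n} {c = c} r)  = suc-+ʳ (countTC n c) _ _ (varRepT-count r)

mutual
  nameRepT-count : ∀ {g u n m A B} → NameRepT g u n m A B → suc (countN n B) ≡ countN n A
  nameRepT-count (nlam r)                 = nameRepT-count r
  nameRepT-count (nappL {s = s} r)        = cong (_+ countN _ s) (nameRepT-count r)
  nameRepT-count (nappR {t = t} r)        = suc-+ʳ (countN _ t) _ _ (nameRepT-count r)
  nameRepT-count (nmu r)                  = nameRepC-count r
  nameRepT-count (nesL {s = s} r)         = cong (_+ countN _ s) (nameRepT-count r)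
  nameRepT-count (nesR {t = t} r)         = suc-+ʳ (countN _ t) _ _ (nameRepT-count r)

  nameRepC-count : ∀ {g u n m A B} → NameRepC g u n m A B → suc (countNC n B) ≡ countNC n A
  nameRepC-count {g} {u} {n} {m} (nhere {t = t}) = begin
    suc (eqCount (n + suc g) n + (countN n t + countN n (replArg n m u)))
      ≡⟨ cong (λ z → suc (z + (countN n t + countN n (replArg n m u)))) (eqCount-beyond n g) ⟩
    suc (countN n t + countN n (replArg n m u))
      ≡⟨ cong (λ z → suc (countN n t + z)) argument-absent ⟩
    suc (countN n t + 0)
      ≡⟨ cong suc (+-identityʳ _) ⟩
    1 + countN n t
      ≡⟨ cong (_+ countN n t) (sym (eqCount-same n)) ⟩
    eqCount n n + countN n t ∎
    where
    open ≡-Reasoning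
    argument-absent : countN n (replArg n m u) ≡ 0
    argument-absent = trans (countN-shiftT m n 0 (shiftN (suc n) 0 u)) (countN-shift-gap (suc n) n 0 u z≤n (s≤s (m≤m+n n 0)))
  nameRepC-count (nnamed {n = n} {a = a} r)        = suc-+ʳ (eqCount a n) _ _ (nameRepT-count r)
  nameRepC-count (nrsL {n = n} {b = b} {s = s} r)  = cong (λ z → z + eqCount b n + countN n s) (nameRepC-count r)
  nameRepC-count (nrsR {n = n} {c = c} {b = b} r)  = suc-+ʳ (countNC (suc n) c + eqCount b n) _ _ (nameRepT-count r)

-- The (d) cases are the heart of the argument: if the erasure p contracts a
-- (d) redex, the corresponding replacement in o may leave further occurrences
-- (they were inside erased subobjects of o).  Then o contracts a (c) redex
-- instead, and the remaining explicit substitution is erased.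

varRep-contract : ∀ {X X' w B r} → VarRepT w 0 0 X X' → X' ⊳T B → shiftT 1 0 r ≡ B →
  Σ Tm λ o' → RedexT (esub X w) o' × o' ⊳T r
varRep-contract {X' = X'} rep e eq with countT 0 X' in left
... | zero with unshiftT 0 X' left
...   | r' , eqr = r' , redDv rep (trans (sym (varRepT-count rep)) (cong suc left)) eqr
                      , ⊳T-unshiftT 0 r' _ (subst (_⊳T _) (sym eqr) e) (sym eq)
varRep-contract {X' = X'} rep e eq | suc k =
  esub X' _ , redCv rep (subst (1 <_) (trans (cong suc (sym left)) (varRepT-count rep)) (s≤s (s≤s z≤n)))
            , edrop (subst (X' ⊳T_) (sym eq) e)

nameRep-contract : ∀ {g X X' w B r} → NameRepC g w 0 0 X X' → X' ⊳C B → shiftNC 1 0 r ≡ B →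
  Σ Cmd λ o' → RedexC (rsub X g w) o' × o' ⊳C r
nameRep-contract {X' = X'} rep e eq with countNC 0 X' in left
... | zero with unshiftNC 0 X' left
...   | r' , eqr = r' , redDn rep (trans (sym (nameRepC-count rep)) (cong suc left)) eqr
                      , ⊳C-unshiftNC 0 r' _ (subst (_⊳C _) (sym eqr) e) (sym eq)
nameRep-contract {X' = X'} rep e eq | suc k =
  rsub X' _ _ , redCn rep (subst (1 <_) (trans (cong suc (sym left)) (nameRepC-count rep)) (s≤s (s≤s z≤n)))
              , edropC (subst (X' ⊳C_) (sym eq) e)

mutual
  ⊳T-simulate : ∀ {o p p'} → o ⊳T p → RedStepT p p' → Σ Tm λ o' → RedStepT o o' × o' ⊳T p'
  ⊳T-simulate (edrop {w = w} e) s with ⊳T-simulate e (RedShift.stepT-shiftT 0 s)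
  ... | o' , s' , e' = esub o' w , esL s' , edrop e'
  ⊳T-simulate evar (root ())
  ⊳T-simulate (elam e) (root ())
  ⊳T-simulate (elam e) (lamS s) with ⊳T-simulate e s
  ... | o' , s' , e' = lam o' , lamS s' , elam e'
  ⊳T-simulate (eapp {u = u} e e₂) (appL s) with ⊳T-simulate e s
  ... | o' , s' , e' = app o' u , appL s' , eapp e' e₂
  ⊳T-simulate (eapp {t = t} e₁ e) (appR s) with ⊳T-simulate e s
  ... | o' , s' , e' = app t o' , appR s' , eapp e₁ e'
  ⊳T-simulate (eapp e₁ e₂) (root (redB br)) with betaAt-lift e₁ br e₂
  ... | o' , br' , e' = o' , root (redB br') , e'
  ⊳T-simulate (eapp e₁ e₂) (root (redM mr)) with muAppAt-lift e₁ mr e₂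
  ... | o' , mr' , e' = o' , root (redM mr') , e'
  ⊳T-simulate (emu e) (root ())
  ⊳T-simulate (emu e) (muS s) with ⊳C-simulate e s
  ... | o' , s' , e' = mu o' , muS s' , emu e'
  ⊳T-simulate (eesub {u = u} e e₂) (esL s) with ⊳T-simulate e s
  ... | o' , s' , e' = esub o' u , esL s' , eesub e' e₂
  ⊳T-simulate (eesub {t = t} e₁ e) (esR s) with ⊳T-simulate e s
  ... | o' , s' , e' = esub t o' , esR s' , eesub e₁ e'
  ⊳T-simulate (eesub {u = w} e₁ e₂) (root (redCv r h)) with varRepT-lift e₁ r e₂
  ... | X' , r' , e' = esub X' w , root (redCv r' (<-≤-trans h (⊳T-countT 0 e₁))) , eesub e' e₂
  ⊳T-simulate (eesub e₁ e₂) (root (redDv r h eq)) with varRepT-lift e₁ r e₂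
  ... | X' , r' , e' with varRep-contract r' e' eq
  ...   | o' , red , e'' = o' , root red , e''

  ⊳C-simulate : ∀ {o p p'} → o ⊳C p → RedStepC p p' → Σ Cmd λ o' → RedStepC o o' × o' ⊳C p'
  ⊳C-simulate (edropC {b = b} {w = w} e) s with ⊳C-simulate e (RedShift.stepC-shiftN 0 s)
  ... | o' , s' , e' = rsub o' b w , rsL s' , edropC e'
  ⊳C-simulate (enamed e) (root ())
  ⊳C-simulate (enamed {a = a} e) (namedS s) with ⊳T-simulate e s
  ... | o' , s' , e' = named a o' , namedS s' , enamed e'
  ⊳C-simulate (ersub {b = b} {u = u} e e₂) (rsL s) with ⊳C-simulate e s
  ... | o' , s' , e' = rsub o' b u , rsL s' , ersub e' e₂
  ⊳C-simulate (ersub {c = c} {b = b} e₁ e) (rsR s) with ⊳T-simulate e s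
  ... | o' , s' , e' = rsub c b o' , rsR s' , ersub e₁ e'
  ⊳C-simulate (ersub {b = b} {u = w} e₁ e₂) (root (redCn r h)) with nameRepC-lift e₁ r e₂
  ... | X' , r' , e' = rsub X' b w , root (redCn r' (<-≤-trans h (⊳C-countNC 0 e₁))) , ersub e' e₂
  ⊳C-simulate (ersub e₁ e₂) (root (redDn r h eq)) with nameRepC-lift e₁ r e₂
  ... | X' , r' , e' with nameRep-contract r' e' eq
  ...   | o' , red , e'' = o' , root red , e''

mutual
  ⊳T-absorb : ∀ {o p p'} → o ⊳T p → WeakStepT p p' → o ⊳T p'
  ⊳T-absorb (edrop e) s                         = edrop (⊳T-absorb e (WeakShift.stepT-shiftT 0 s))
  ⊳T-absorb evar (root ())
  ⊳T-absorb (elam e) (root ())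
  ⊳T-absorb (elam e) (lamS s)                   = elam (⊳T-absorb e s)
  ⊳T-absorb (eapp e e₂) (root ())
  ⊳T-absorb (eapp e e₂) (appL s)                = eapp (⊳T-absorb e s) e₂
  ⊳T-absorb (eapp e₁ e) (appR s)                = eapp e₁ (⊳T-absorb e s)
  ⊳T-absorb (emu e) (root ())
  ⊳T-absorb (emu e) (muS s)                     = emu (⊳C-absorb e s)
  ⊳T-absorb (eesub e e₂) (esL s)                = eesub (⊳T-absorb e s) e₂
  ⊳T-absorb (eesub e₁ e) (esR s)                = eesub e₁ (⊳T-absorb e s)
  ⊳T-absorb (eesub e₁ e₂) (root (ruleWv t u))   = edrop e₁

  ⊳C-absorb : ∀ {o p p'} → o ⊳C p → WeakStepC p p' → o ⊳C p'
  ⊳C-absorb (edropC e) s                        = edropC (⊳C-absorb e (WeakShift.stepC-shiftN 0 s))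
  ⊳C-absorb (enamed e) (root ())
  ⊳C-absorb (enamed e) (namedS s)               = enamed (⊳T-absorb e s)
  ⊳C-absorb (ersub e e₂) (rsL s)                = ersub (⊳C-absorb e s) e₂
  ⊳C-absorb (ersub e₁ e) (rsR s)                = ersub e₁ (⊳T-absorb e s)
  ⊳C-absorb (ersub e₁ e₂) (root (ruleWn c γ u)) = edropC e₁

mutual
  sizeT : Tm → ℕ
  sizeT (var i)    = 1
  sizeT (lam t)    = suc (sizeT t)
  sizeT (app t u)  = suc (sizeT t + sizeT u)
  sizeT (mu c)     = suc (sizeC c)
  sizeT (esub t u) = suc (sizeT t + sizeT u)

  sizeC : Cmd → ℕ
  sizeC (named a t)  = suc (sizeT t)
  sizeC (rsub c b u) = suc (sizeC c + sizeT u)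

mutual
  sizeT-shiftT : ∀ d c t → sizeT (shiftT d c t) ≡ sizeT t
  sizeT-shiftT d c (var i)    = refl
  sizeT-shiftT d c (lam t)    = cong suc (sizeT-shiftT d (suc c) t)
  sizeT-shiftT d c (app t u)  = cong suc (cong₂ _+_ (sizeT-shiftT d c t) (sizeT-shiftT d c u))
  sizeT-shiftT d c (mu x)     = cong suc (sizeC-shiftTC d c x)
  sizeT-shiftT d c (esub t u) = cong suc (cong₂ _+_ (sizeT-shiftT d (suc c) t) (sizeT-shiftT d c u))

  sizeC-shiftTC : ∀ d c x → sizeC (shiftTC d c x) ≡ sizeC x
  sizeC-shiftTC d c (named a t)  = cong suc (sizeT-shiftT d c t)
  sizeC-shiftTC d c (rsub x b u) = cong suc (cong₂ _+_ (sizeC-shiftTC d c x) (sizeT-shiftT d c u))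

mutual
  sizeT-shiftN : ∀ d c t → sizeT (shiftN d c t) ≡ sizeT t
  sizeT-shiftN d c (var i)    = refl
  sizeT-shiftN d c (lam t)    = cong suc (sizeT-shiftN d c t)
  sizeT-shiftN d c (app t u)  = cong suc (cong₂ _+_ (sizeT-shiftN d c t) (sizeT-shiftN d c u))
  sizeT-shiftN d c (mu x)     = cong suc (sizeC-shiftNC d (suc c) x)
  sizeT-shiftN d c (esub t u) = cong suc (cong₂ _+_ (sizeT-shiftN d c t) (sizeT-shiftN d c u))

  sizeC-shiftNC : ∀ d c x → sizeC (shiftNC d c x) ≡ sizeC x
  sizeC-shiftNC d c (named a t)  = cong suc (sizeT-shiftN d c t)
  sizeC-shiftNC d c (rsub x b u) = cong suc (cong₂ _+_ (sizeC-shiftNC d (suc c) x) (sizeT-shiftN d c u))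

mutual
  weakStepT-size : ∀ {a b} → WeakStepT a b → sizeT b < sizeT a
  weakStepT-size (root (ruleWv t u)) = s≤s (≤-trans (≤-reflexive (sym (sizeT-shiftT 1 0 t))) (m≤m+n _ _))
  weakStepT-size (lamS s) = s≤s (weakStepT-size s)
  weakStepT-size (appL s) = s≤s (+-monoˡ-< _ (weakStepT-size s))
  weakStepT-size (appR s) = s≤s (+-monoʳ-< _ (weakStepT-size s))
  weakStepT-size (muS s)  = s≤s (weakStepC-size s)
  weakStepT-size (esL s)  = s≤s (+-monoˡ-< _ (weakStepT-size s))
  weakStepT-size (esR s)  = s≤s (+-monoʳ-< _ (weakStepT-size s))

  weakStepC-size : ∀ {a b} → WeakStepC a b → sizeC b < sizeC a
  weakStepC-size (root (ruleWn c γ u)) = s≤s (≤-trans (≤-reflexive (sym (sizeC-shiftNC 1 0 c))) (m≤m+n _ _))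
  weakStepC-size (namedS s) = s≤s (weakStepT-size s)
  weakStepC-size (rsL s)    = s≤s (+-monoˡ-< _ (weakStepC-size s))
  weakStepC-size (rsR s)    = s≤s (+-monoʳ-< _ (weakStepT-size s))

module _ {R₁ R₂ : Tm → Tm → Set} {S₁ S₂ : Cmd → Cmd → Set} where
  mutual
    splitStepT : ∀ {a b} → StepT (λ x y → R₁ x y ⊎ R₂ x y) (λ x y → S₁ x y ⊎ S₂ x y) a b →
                 StepT R₁ S₁ a b ⊎ StepT R₂ S₂ a b
    splitStepT (root (inj₁ x)) = inj₁ (root x)
    splitStepT (root (inj₂ x)) = inj₂ (root x)
    splitStepT (lamS s) = Sum.map lamS lamS (splitStepT s)
    splitStepT (appL s) = Sum.map appL appL (splitStepT s)
    splitStepT (appR s) = Sum.map appR appR (splitStepT s)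
    splitStepT (muS s)  = Sum.map muS muS (splitStepC s)
    splitStepT (esL s)  = Sum.map esL esL (splitStepT s)
    splitStepT (esR s)  = Sum.map esR esR (splitStepT s)

    splitStepC : ∀ {a b} → StepC (λ x y → R₁ x y ⊎ R₂ x y) (λ x y → S₁ x y ⊎ S₂ x y) a b →
                 StepC R₁ S₁ a b ⊎ StepC R₂ S₂ a b
    splitStepC (root (inj₁ x)) = inj₁ (root x)
    splitStepC (root (inj₂ x)) = inj₂ (root x)
    splitStepC (namedS s) = Sum.map namedS namedS (splitStepT s)
    splitStepC (rsL s)    = Sum.map rsL rsL (splitStepC s)
    splitStepC (rsR s)    = Sum.map rsR rsR (splitStepT s)

infix 4 _⊳_

data _⊳_ : Obj → Obj → Set where
  etm  : ∀ {a b} → a ⊳T b → tm a ⊳ tm b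
  ecmd : ∀ {a b} → a ⊳C b → cmd a ⊳ cmd b

⊳-refl : ∀ o → o ⊳ o
⊳-refl (tm t)  = etm (⊳T-refl t)
⊳-refl (cmd c) = ecmd (⊳C-refl c)

sizeO : Obj → ℕ
sizeO (tm t)  = sizeT t
sizeO (cmd c) = sizeC c

_⟶w_ : Obj → Obj → Set
_⟶w_ = StepO RootWT RootWC

λμs-split : ∀ {p p'} → p ⟶λμs p' → p ⟶λμs̄ p' ⊎ p ⟶w p'
λμs-split (tmS s)  = Sum.map tmS tmS (splitStepT s)
λμs-split (cmdS s) = Sum.map cmdS cmdS (splitStepC s)

⊳-simulate : ∀ {o p p'} → o ⊳ p → p ⟶λμs̄ p' → Σ Obj λ o' → o ⟶λμs̄ o' × o' ⊳ p'
⊳-simulate (etm e) (tmS s) with ⊳T-simulate e (mapStepT rootT→redexT rootC→redexC s)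
... | o' , s' , e' = tm o' , tmS (mapStepT redexT→rootT redexC→rootC s') , etm e'
⊳-simulate (ecmd e) (cmdS s) with ⊳C-simulate e (mapStepC rootT→redexT rootC→redexC s)
... | o' , s' , e' = cmd o' , cmdS (mapStepC redexT→rootT redexC→rootC s') , ecmd e'

⊳-absorb : ∀ {o p p'} → o ⊳ p → p ⟶w p' → o ⊳ p'
⊳-absorb (etm e)  (tmS s)  = etm (⊳T-absorb e s)
⊳-absorb (ecmd e) (cmdS s) = ecmd (⊳C-absorb e s)

weakStep-size : ∀ {p p'} → p ⟶w p' → sizeO p' < sizeO p
weakStep-size (tmS s)  = weakStepT-size s
weakStep-size (cmdS s) = weakStepC-size s

-- Every erasure of a λμs̄-SN object is λμs-SN: induction on the λμs̄-SN
-- derivation of o, and for fixed o on the size of the erasure p.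
mutual
  SN-erasure : ∀ {o p} → SN _⟶λμs̄_ o → Acc _<_ (sizeO p) → o ⊳ p → SN _⟶λμs_ p
  SN-erasure snₒ accₚ o⊳p = acc (λ p⟶p' → SN-erasure-step snₒ accₚ o⊳p (λμs-split p⟶p'))

  SN-erasure-step : ∀ {o p p'} → SN _⟶λμs̄_ o → Acc _<_ (sizeO p) → o ⊳ p →
                    p ⟶λμs̄ p' ⊎ p ⟶w p' → SN _⟶λμs_ p'
  SN-erasure-step (acc next) _ o⊳p (inj₁ nonErasing) =
    let (o' , o⟶o' , o'⊳p') = ⊳-simulate o⊳p nonErasing
    in  SN-erasure (next o⟶o') (<-wellFounded _) o'⊳p'
  SN-erasure-step snₒ (acc smaller) o⊳p (inj₂ erasing) =
    SN-erasure snₒ (smaller (weakStep-size erasing)) (⊳-absorb o⊳p erasing)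

lemma8p3 : (o : Obj) → SN _⟶λμs̄_ o → SN _⟶λμs_ o
lemma8p3 o sn = SN-erasure sn (<-wellFounded (sizeO o)) (⊳-refl o)
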